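{- Let $T:\mathbb{F}_q^n\to\mathbb{F}_q^n$ be a linear map. For integers $0\le b\le a\le n$ let $N(a,b)$ denote the number of $a$-dimensional subspaces $W\subseteq\mathbb{F}_q^n$ such that $\dim(W\cap T^{ -1}W)=b$, and let $X_a^T=N(a,a)$ be the number of $a$-dimensional $T$-invariant subspaces. Then for all integers $n\ge a>b\ge0$, \[ N(a,b)=X_b^T{n-b\brack a-b}_q-X_a^T{a\brack b}_q+\sum_{j=0}^{b-1}N(b,j){n-2b+j\brack a-2b+j}_q-\sum_{k=b+1}^{a-1}N(a,k){k\brack b}_q. \]
   Context: $T^{ -1}W$ denotes the preimage $\{v: Tv\in W\}$. ${n\brack k}_q$ is the Gaussian binomial coefficient (number of $k$-dimensional subspaces of $\mathbb{F}_q^n$), taken to be $0$ if $k<0$ or $k>n$. -}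

module Defs where

open import Data.Nat as ℕ using (ℕ; zero; suc)
open import Data.Integer as ℤ using (ℤ; +_)
open import Data.List as List using (List; []; _∷_; length; map; concatMap; upTo; foldr)
open import Data.List.Membership.Propositional using (_∈_)
open import Data.List.Relation.Unary.Unique.Propositional using (Unique)
open import Data.Vec as Vec using (Vec; zipWith; replicate)
open import Data.Vec.Relation.Unary.All as VAll using ()
open import Data.Product using (Σ; Σ-syntax; _×_)
open import Function.Bundles using (_⇔_)
open import Relation.Binary.PropositionalEquality using (_≡_; _≢_)
open import Relation.Binary.Definitions using (DecidableEquality)
open import Algebra.Structures using (IsCommutativeRing)

record FiniteField : Set₁ where
  field
    Carrier   : Set
    _+_ _*_   : Carrier → Carrier → Carrier
    -_        : Carrier → Carrier
    0# 1#     : Carrier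
    isCommutativeRing : IsCommutativeRing _≡_ _+_ _*_ -_ 0# 1#
    0≢1       : 0# ≢ 1#
    inverse   : ∀ x → x ≢ 0# → Σ Carrier (λ y → x * y ≡ 1#)
    _≟_       : DecidableEquality Carrier
    elements  : List Carrier
    elements-unique   : Unique elements
    elements-complete : ∀ x → x ∈ elements

  q : ℕ
  q = length elements

-- Gaussian binomial coefficients  [n k]_q  (number of k-dim subspaces of F_q^n),
-- via the q-Pascal rule  [n+1, k+1] = [n, k] + q^(k+1) [n, k+1].

gauss : ℕ → ℕ → ℕ → ℕ
gauss q n       zero    = 1
gauss q zero    (suc k) = 0
gauss q (suc n) (suc k) = gauss q n k ℕ.+ q ℕ.^ (suc k) ℕ.* gauss q n (suc k)

-- Integer-argument version, 0 when k < 0 (or n < 0, which forces k > n or k < 0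
-- whenever k ≥ 0 too); [n k]_q = 0 for k > n holds automatically for gauss.
gaussℤ : ℕ → ℤ → ℤ → ℤ
gaussℤ q (+ n) (+ k) = + gauss q n k
gaussℤ q _     _     = + 0

-- ∑_{k = lo}^{hi - 1} f k   (empty if hi ≤ lo)
∑[_,_⟩ : ℕ → ℕ → (ℕ → ℤ) → ℤ
∑[ lo , hi ⟩ f = foldr ℤ._+_ (+ 0) (map (λ i → f (lo ℕ.+ i)) (upTo (hi ℕ.∸ lo)))

module _ (F : FiniteField) where
  open FiniteField F

  V : ℕ → Set
  V n = Vec Carrier n

  _⊕_ : ∀ {n} → V n → V n → V n
  _⊕_ = zipWith _+_

  _·_ : ∀ {n} → Carrier → V n → V n
  c · v = Vec.map (c *_) v

  0v : ∀ {n} → V n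
  0v = replicate _ 0#

  allVecs : (n : ℕ) → List (V n)
  allVecs zero    = Vec.[] ∷ []
  allVecs (suc n) = concatMap (λ x → map (x Vec.∷_) (allVecs n)) elements

  IsLinear : ∀ {n} → (V n → V n) → Set
  IsLinear T = (∀ u v → T (u ⊕ v) ≡ T u ⊕ T v) × (∀ c v → T (c · v) ≡ c · T v)

  lincomb : ∀ {n d} → Vec Carrier d → Vec (V n) d → V n
  lincomb Vec.[]       Vec.[]       = 0v
  lincomb (c Vec.∷ cs) (b Vec.∷ bs) = (c · b) ⊕ lincomb cs bs

  LinIndep : ∀ {n d} → Vec (V n) d → Set
  LinIndep {d = d} B = ∀ c → lincomb c B ≡ 0v → c ≡ replicate d 0#

  HasDim : ∀ {n} → (V n → Set) → ℕ → Set
  HasDim {n} P d =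
    Σ[ B ∈ Vec (V n) d ]
      (VAll.All P B × LinIndep B × (∀ w → P w → Σ[ c ∈ Vec Carrier d ] lincomb c B ≡ w))

  -- A subset of F_q^n is represented canonically as a sublist of allVecs.
  IsSubspace : ∀ {n} → List (V n) → Set
  IsSubspace W =
    (0v ∈ W) × (∀ u v → u ∈ W → v ∈ W → (u ⊕ v) ∈ W) × (∀ c v → v ∈ W → (c · v) ∈ W)

sublists : ∀ {A : Set} → List A → List (List A)
sublists []       = [] ∷ []
sublists (x ∷ xs) = sublists xs List.++ map (x ∷_) (sublists xs)

module _ (F : FiniteField) where
  open FiniteField F

  CountSubsets : (n : ℕ) → (List (V F n) → Set) → ℕ → Set
  CountSubsets n P m =
    Σ[ L ∈ List (List (V F n)) ]
      (Unique L × (∀ W → (W ∈ L) ⇔ ((W ∈ sublists (allVecs F n)) × P W)) × length L ≡ m)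

  NProp : ∀ {n} → (V F n → V F n) → ℕ → ℕ → List (V F n) → Set
  NProp T a b W =
    IsSubspace F W × HasDim F (_∈ W) a × HasDim F (λ v → (v ∈ W) × (T v ∈ W)) b

module Submission where

-- Count the pairs (U, W) of subspaces with dim U = b, dim W = a and U ⊆ W ∩ T⁻¹W in two ways.
-- For fixed W with dim (W ∩ T⁻¹W) = k there are [k, b]_q choices of U.  For fixed U with
-- dim (U ∩ T⁻¹U) = j the condition says W ⊇ U + T U, a space of dimension 2b − j, so there are
-- [n − 2b + j, a − 2b + j]_q choices of W.  Hence Σ_k N(a,k) [k, b]_q = Σ_j N(b,j) [n − 2b + j, a − 2b + j]_q,
-- and as [k, b]_q is 0 for k < b and 1 for k = b, isolating N(a,b) gives the formula.
-- Both inner counts are instances of one fact: the e-dimensional X with Y ⊆ X ⊆ Z, dim Y = d, dim Z = m,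
-- number [m − d, e − d]_q, seen by counting the pairs (X, t) with t an independent extension of a basis
-- of Y by e − d vectors of X.

open import Defs using (FiniteField; V; IsLinear; CountSubsets; NProp; gaussℤ; ∑[_,_⟩)
open import Data.Nat using (ℕ; _≤_; _<_; suc)
open import Relation.Binary.PropositionalEquality using (_≡_)

module Counting where

  open import Data.Nat using (ℕ; zero; suc; _+_; _*_; _≤_; _<_; z≤n; s≤s)
  open import Data.Nat.Properties
  open import Algebra.Properties.CommutativeSemigroup +-commutativeSemigroup using (interchange)
  open import Data.List using (List; []; _∷_; [_]; map; _++_; length; upTo)
  open import Data.List.Properties using (upTo-∷ʳ)
  open import Data.List.Membership.Propositional using (_∈_)
  open import Data.List.Relation.Unary.Any using (here; there)
  open import Data.Product using (_×_; _,_; proj₁; proj₂)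
  open import Data.Empty using (⊥-elim)
  open import Relation.Nullary using (Dec; yes; no; ¬_)
  open import Relation.Unary using (Decidable)
  open import Relation.Binary.PropositionalEquality hiding ([_])

  𝟙 : ∀ {P : Set} → Dec P → ℕ
  𝟙 (yes _) = 1
  𝟙 (no _)  = 0

  𝟙-yes : ∀ {P : Set} (P? : Dec P) → P → 𝟙 P? ≡ 1
  𝟙-yes (yes _) _ = refl
  𝟙-yes (no ¬p) p = ⊥-elim (¬p p)

  𝟙-no : ∀ {P : Set} (P? : Dec P) → ¬ P → 𝟙 P? ≡ 0
  𝟙-no (yes p) ¬p = ⊥-elim (¬p p)
  𝟙-no (no _)  _  = refl

  𝟙≤1 : ∀ {P : Set} (P? : Dec P) → 𝟙 P? ≤ 1
  𝟙≤1 (yes _) = s≤s z≤n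
  𝟙≤1 (no _)  = z≤n

  𝟙-mono : ∀ {P Q : Set} (P? : Dec P) (Q? : Dec Q) → (P → Q) → 𝟙 P? ≤ 𝟙 Q?
  𝟙-mono (yes p) (yes q) f = ≤-refl
  𝟙-mono (yes p) (no ¬q) f = ⊥-elim (¬q (f p))
  𝟙-mono (no ¬p) Q?      f = z≤n

  𝟙-cong : ∀ {P Q : Set} (P? : Dec P) (Q? : Dec Q) → (P → Q) → (Q → P) → 𝟙 P? ≡ 𝟙 Q?
  𝟙-cong P? Q? f g = ≤-antisym (𝟙-mono P? Q? f) (𝟙-mono Q? P? g)

  𝟙-× : ∀ {P Q : Set} (P? : Dec P) (Q? : Dec Q) (P×Q? : Dec (P × Q)) → 𝟙 P×Q? ≡ 𝟙 P? * 𝟙 Q?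
  𝟙-× (yes p) (yes q) P×Q? = 𝟙-yes P×Q? (p , q)
  𝟙-× (yes p) (no ¬q) P×Q? = 𝟙-no P×Q? (λ pq → ¬q (proj₂ pq))
  𝟙-× (no ¬p) Q?      P×Q? = 𝟙-no P×Q? (λ pq → ¬p (proj₁ pq))

  sumOver : ∀ {A : Set} → List A → (A → ℕ) → ℕ
  sumOver []       f = 0
  sumOver (x ∷ xs) f = f x + sumOver xs f

  sumOver-cong : ∀ {A : Set} (xs : List A) {f g : A → ℕ} → (∀ x → x ∈ xs → f x ≡ g x) →
                 sumOver xs f ≡ sumOver xs g
  sumOver-cong []       h = refl
  sumOver-cong (x ∷ xs) h = cong₂ _+_ (h x (here refl)) (sumOver-cong xs (λ y y∈ → h y (there y∈)))

  sumOver-mono : ∀ {A : Set} (xs : List A) {f g : A → ℕ} → (∀ x → x ∈ xs → f x ≤ g x) →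
                 sumOver xs f ≤ sumOver xs g
  sumOver-mono []       h = z≤n
  sumOver-mono (x ∷ xs) h = +-mono-≤ (h x (here refl)) (sumOver-mono xs (λ y y∈ → h y (there y∈)))

  sumOver-+ : ∀ {A : Set} (xs : List A) (f g : A → ℕ) →
              sumOver xs (λ x → f x + g x) ≡ sumOver xs f + sumOver xs g
  sumOver-+ []       f g = refl
  sumOver-+ (x ∷ xs) f g =
    trans (cong (f x + g x +_) (sumOver-+ xs f g)) (interchange (f x) (g x) _ _)

  sumOver-*ˡ : ∀ {A : Set} (xs : List A) c (f : A → ℕ) → sumOver xs (λ x → c * f x) ≡ c * sumOver xs f
  sumOver-*ˡ []       c f = sym (*-zeroʳ c)
  sumOver-*ˡ (x ∷ xs) c f =
    trans (cong (c * f x +_) (sumOver-*ˡ xs c f)) (sym (*-distribˡ-+ c (f x) _))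

  sumOver-*ʳ : ∀ {A : Set} (xs : List A) c (f : A → ℕ) → sumOver xs (λ x → f x * c) ≡ sumOver xs f * c
  sumOver-*ʳ xs c f =
    trans (sumOver-cong xs (λ x _ → *-comm (f x) c)) (trans (sumOver-*ˡ xs c f) (*-comm c _))

  sumOver-zero : ∀ {A : Set} (xs : List A) → sumOver xs (λ _ → 0) ≡ 0
  sumOver-zero []       = refl
  sumOver-zero (x ∷ xs) = sumOver-zero xs

  sumOver-one : ∀ {A : Set} (xs : List A) → sumOver xs (λ _ → 1) ≡ length xs
  sumOver-one []       = refl
  sumOver-one (x ∷ xs) = cong suc (sumOver-one xs)

  sumOver-const : ∀ {A : Set} (xs : List A) c → sumOver xs (λ _ → c) ≡ length xs * c
  sumOver-const []       c = refl
  sumOver-const (x ∷ xs) c = cong (c +_) (sumOver-const xs c)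

  sumOver-++ : ∀ {A : Set} (xs ys : List A) (f : A → ℕ) → sumOver (xs ++ ys) f ≡ sumOver xs f + sumOver ys f
  sumOver-++ []       ys f = refl
  sumOver-++ (x ∷ xs) ys f = trans (cong (f x +_) (sumOver-++ xs ys f)) (sym (+-assoc (f x) _ _))

  sumOver-map : ∀ {A B : Set} (g : A → B) (xs : List A) (f : B → ℕ) →
                sumOver (map g xs) f ≡ sumOver xs (λ x → f (g x))
  sumOver-map g []       f = refl
  sumOver-map g (x ∷ xs) f = cong (f (g x) +_) (sumOver-map g xs f)

  sumOver-swap : ∀ {A B : Set} (xs : List A) (ys : List B) (f : A → B → ℕ) →
                 sumOver xs (λ x → sumOver ys (f x)) ≡ sumOver ys (λ y → sumOver xs (λ x → f x y))
  sumOver-swap []       ys f = sym (sumOver-zero ys)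
  sumOver-swap (x ∷ xs) ys f =
    trans (cong (sumOver ys (f x) +_) (sumOver-swap xs ys f)) (sym (sumOver-+ ys (f x) _))

  sumOver-upTo-suc : ∀ (f : ℕ → ℕ) m → sumOver (upTo (suc m)) f ≡ sumOver (upTo m) f + f m
  sumOver-upTo-suc f m = begin
    sumOver (upTo (suc m)) f        ≡⟨ cong (λ xs → sumOver xs f) (sym (upTo-∷ʳ m)) ⟩
    sumOver (upTo m ++ [ m ]) f     ≡⟨ sumOver-++ (upTo m) [ m ] f ⟩
    sumOver (upTo m) f + (f m + 0)  ≡⟨ cong (sumOver (upTo m) f +_) (+-identityʳ (f m)) ⟩
    sumOver (upTo m) f + f m        ∎
    where open ≡-Reasoning

  sumOver-upTo-+ : ∀ (f : ℕ → ℕ) m k →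
                   sumOver (upTo (m + k)) f ≡ sumOver (upTo m) f + sumOver (upTo k) (λ i → f (m + i))
  sumOver-upTo-+ f m zero    = trans (cong (λ z → sumOver (upTo z) f) (+-identityʳ m)) (sym (+-identityʳ _))
  sumOver-upTo-+ f m (suc k) = begin
    sumOver (upTo (m + suc k)) f
      ≡⟨ cong (λ z → sumOver (upTo z) f) (+-suc m k) ⟩
    sumOver (upTo (suc (m + k))) f
      ≡⟨ sumOver-upTo-suc f (m + k) ⟩
    sumOver (upTo (m + k)) f + f (m + k)
      ≡⟨ cong (_+ f (m + k)) (sumOver-upTo-+ f m k) ⟩
    sumOver (upTo m) f + sumOver (upTo k) g + g k
      ≡⟨ +-assoc (sumOver (upTo m) f) _ _ ⟩
    sumOver (upTo m) f + (sumOver (upTo k) g + g k)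
      ≡⟨ cong (sumOver (upTo m) f +_) (sym (sumOver-upTo-suc g k)) ⟩
    sumOver (upTo m) f + sumOver (upTo (suc k)) g ∎
    where
    open ≡-Reasoning
    g : ℕ → ℕ
    g i = f (m + i)

  module _ {A : Set} where

    count : ∀ {P : A → Set} → Decidable P → List A → ℕ
    count P? xs = sumOver xs (λ x → 𝟙 (P? x))

    module _ {P Q : A → Set} (P? : Decidable P) (Q? : Decidable Q) where

      count-cong : ∀ xs → (∀ x → x ∈ xs → P x → Q x) → (∀ x → x ∈ xs → Q x → P x) →
                   count P? xs ≡ count Q? xs
      count-cong xs f g = sumOver-cong xs (λ x x∈ → 𝟙-cong (P? x) (Q? x) (f x x∈) (g x x∈))

      count-mono : ∀ xs → (∀ x → x ∈ xs → P x → Q x) → count P? xs ≤ count Q? xs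
      count-mono xs f = sumOver-mono xs (λ x x∈ → 𝟙-mono (P? x) (Q? x) (f x x∈))

      count-mono-< : ∀ xs → (∀ x → x ∈ xs → P x → Q x) →
                     ∀ y → y ∈ xs → Q y → ¬ P y → count P? xs < count Q? xs
      count-mono-< (x ∷ xs) f y (here refl) qy ¬py
        rewrite 𝟙-no (P? y) ¬py | 𝟙-yes (Q? y) qy = s≤s (count-mono xs (λ z z∈ → f z (there z∈)))
      count-mono-< (x ∷ xs) f y (there y∈) qy ¬py =
        +-mono-≤-< (𝟙-mono (P? x) (Q? x) (f x (here refl)))
                   (count-mono-< xs (λ z z∈ → f z (there z∈)) y y∈ qy ¬py)

      count-difference : ∀ xs → (∀ x → x ∈ xs → P x → Q x) → (Q∖P? : Decidable (λ x → Q x × ¬ P x)) →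
                         count Q∖P? xs + count P? xs ≡ count Q? xs
      count-difference xs f Q∖P? =
        trans (sym (sumOver-+ xs _ _)) (sumOver-cong xs (λ x x∈ → split (P? x) (Q? x) (Q∖P? x) (f x x∈)))
        where
        split : ∀ {P Q : Set} (P? : Dec P) (Q? : Dec Q) (Q∖P? : Dec (Q × ¬ P)) → (P → Q) →
                𝟙 Q∖P? + 𝟙 P? ≡ 𝟙 Q?
        split (yes p) Q?      Q∖P? h rewrite 𝟙-no Q∖P? (λ qp → proj₂ qp p) | 𝟙-yes Q? (h p) = refl
        split (no ¬p) (yes q) Q∖P? h rewrite 𝟙-yes Q∖P? (q , ¬p) = refl
        split (no ¬p) (no ¬q) Q∖P? h rewrite 𝟙-no Q∖P? (λ qp → ¬q (proj₁ qp)) = refl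

    module _ {P : A → Set} (P? : Decidable P) where

      count-none : ∀ xs → (∀ x → x ∈ xs → ¬ P x) → count P? xs ≡ 0
      count-none xs h = trans (sumOver-cong xs (λ x x∈ → 𝟙-no (P? x) (h x x∈))) (sumOver-zero xs)

      count-all : ∀ xs → (∀ x → x ∈ xs → P x) → count P? xs ≡ length xs
      count-all xs h = trans (sumOver-cong xs (λ x x∈ → 𝟙-yes (P? x) (h x x∈))) (sumOver-one xs)

      count≤length : ∀ xs → count P? xs ≤ length xs
      count≤length xs = subst (count P? xs ≤_) (sumOver-one xs) (sumOver-mono xs (λ x _ → 𝟙≤1 (P? x)))

      count-const× : ∀ {B : Set} (B? : Dec B) (B×P? : Decidable (λ x → B × P x)) xs →
                     count B×P? xs ≡ 𝟙 B? * count P? xs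
      count-const× B? B×P? xs =
        trans (sumOver-cong xs (λ x _ → 𝟙-× B? (P? x) (B×P? x))) (sumOver-*ˡ xs (𝟙 B?) _)

module Enumeration where

  open Counting
  open import Defs using (sublists)
  open import Data.Nat using (ℕ; zero; suc; _+_; _*_; _^_)
  import Data.Nat.Properties as ℕₚ
  open import Data.List using (List; []; _∷_; map; concatMap; _++_; length; filter; cartesianProductWith)
  open import Data.List.Properties using (∷-injectiveʳ)
  open import Data.List.Membership.Propositional using (_∈_; _∉_; find; lose)
  open import Data.List.Membership.Propositional.Properties
    using (∈-++⁻; ∈-++⁺ˡ; ∈-++⁺ʳ; ∈-map⁻; ∈-map⁺; ∈-cartesianProductWith⁺)
  open import Data.List.Relation.Unary.Any as Any using (here; there)
  open import Data.List.Relation.Unary.All as All using ([]; _∷_)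
  open import Data.List.Relation.Unary.Unique.Propositional using (Unique; []; _∷_)
  import Data.List.Relation.Unary.Unique.Propositional.Properties as Uniqueₚ
  open import Data.Vec as Vec using (Vec)
  import Data.Vec.Properties as Vecₚ
  open import Data.Product using (Σ; _×_; _,_; proj₁; proj₂)
  open import Data.Sum using (inj₁; inj₂)
  open import Data.Empty using (⊥; ⊥-elim)
  open import Relation.Nullary using (Dec; yes; no; ¬_; does)
  open import Data.Bool using (true; false)
  open import Relation.Unary using (Decidable)
  import Relation.Nullary.Decidable as Dec
  open import Relation.Binary.Definitions using (DecidableEquality)
  open import Relation.Binary.PropositionalEquality

  module _ {A : Set} where

    head∉tail : ∀ {x : A} {xs} → Unique (x ∷ xs) → x ∉ xs
    head∉tail (x≢ ∷ _) x∈ = All.lookup x≢ x∈ refl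

    count-unique : ∀ {P : A → Set} (P? : Decidable P) {xs} → Unique xs →
                   ∀ {x} → x ∈ xs → P x → (∀ y → y ∈ xs → P y → y ≡ x) → count P? xs ≡ 1
    count-unique P? {x ∷ xs} u@(_ ∷ _) (here refl) px only
      rewrite 𝟙-yes (P? x) px
            | count-none P? xs (λ y y∈ py → head∉tail u (subst (_∈ xs) (only y (there y∈) py) y∈)) = refl
    count-unique P? {y ∷ xs} u@(_ ∷ u′) (there x∈) px only
      rewrite 𝟙-no (P? y) (λ py → head∉tail u (subst (_∈ xs) (sym (only y (here refl) py)) x∈)) =
      count-unique P? u′ x∈ px (λ z z∈ → only z (there z∈))

    module _ (_≟_ : DecidableEquality A) where

      length≡count : ∀ {P : A → Set} (P? : Decidable P) {L U : List A} → Unique L → Unique U →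
                     (∀ x → x ∈ L → x ∈ U × P x) → (∀ x → x ∈ U → P x → x ∈ L) → length L ≡ count P? U
      length≡count {P} P? {L} {U} uL uU L⊆ ⊆L = begin
        length L                                        ≡⟨ sym (sumOver-one L) ⟩
        sumOver L (λ _ → 1)                             ≡⟨ sumOver-cong L (λ x x∈ → sym (once-in-U x x∈)) ⟩
        sumOver L (λ x → sumOver U (λ y → 𝟙 (y ≟ x)))   ≡⟨ sumOver-swap L U _ ⟩
        sumOver U (λ y → sumOver L (λ x → 𝟙 (y ≟ x)))   ≡⟨ sumOver-cong U (λ y y∈ → in-L y y∈ (P? y)) ⟩
        count P? U                                      ∎
        where
        open ≡-Reasoning
        once-in-U : ∀ x → x ∈ L → count (_≟ x) U ≡ 1
        once-in-U x x∈ = count-unique (_≟ x) uU (proj₁ (L⊆ x x∈)) refl (λ _ _ y≡x → y≡x)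
        in-L : ∀ y → y ∈ U → (py? : Dec (P y)) → count (y ≟_) L ≡ 𝟙 py?
        in-L y y∈ (yes py) = count-unique (y ≟_) uL (⊆L y y∈ py) refl (λ _ _ y≡x → sym y≡x)
        in-L y y∈ (no ¬py) = count-none (y ≟_) L (λ { x x∈ refl → ¬py (proj₂ (L⊆ x x∈)) })

    ∈-sublists⁻ : ∀ {xs : List A} {W w} → W ∈ sublists xs → w ∈ W → w ∈ xs
    ∈-sublists⁻ {[]}     (here refl) ()
    ∈-sublists⁻ {x ∷ xs} W∈ w∈ with ∈-++⁻ (sublists xs) W∈
    ... | inj₁ W∈₁ = there (∈-sublists⁻ W∈₁ w∈)
    ... | inj₂ W∈₂ with ∈-map⁻ (x ∷_) W∈₂
    ...   | W₀ , W₀∈ , refl with w∈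
    ...     | here refl = here refl
    ...     | there w∈₀ = there (∈-sublists⁻ W₀∈ w∈₀)

    sublists-unique : ∀ {xs : List A} → Unique xs → Unique (sublists xs)
    sublists-unique {[]}     _ = [] ∷ []
    sublists-unique {x ∷ xs} u@(_ ∷ u′) =
      Uniqueₚ.++⁺ IH (Uniqueₚ.map⁺ ∷-injectiveʳ IH) disjoint
      where
      IH : Unique (sublists xs)
      IH = sublists-unique u′
      disjoint : ∀ {V} → V ∈ sublists xs × V ∈ map (x ∷_) (sublists xs) → ⊥
      disjoint (V∈ , xV∈) with ∈-map⁻ (x ∷_) xV∈
      ... | _ , _ , refl = head∉tail u (∈-sublists⁻ V∈ (here refl))

    sublists-canonical : ∀ {xs : List A} {W W′} → Unique xs → W ∈ sublists xs → W′ ∈ sublists xs →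
                         (∀ w → w ∈ W → w ∈ W′) → (∀ w → w ∈ W′ → w ∈ W) → W ≡ W′
    sublists-canonical {[]} _ (here refl) (here refl) _ _ = refl
    sublists-canonical {x ∷ xs} u@(_ ∷ u′) W∈ W′∈ W⊆ ⊇W with ∈-++⁻ (sublists xs) W∈ | ∈-++⁻ (sublists xs) W′∈
    ... | inj₁ a | inj₁ b = sublists-canonical u′ a b W⊆ ⊇W
    ... | inj₁ a | inj₂ b with ∈-map⁻ (x ∷_) b
    ...   | _ , _ , refl = ⊥-elim (head∉tail u (∈-sublists⁻ a (⊇W x (here refl))))
    sublists-canonical {x ∷ xs} u@(_ ∷ u′) W∈ W′∈ W⊆ ⊇W | inj₂ a | inj₁ b with ∈-map⁻ (x ∷_) a
    ...   | _ , _ , refl = ⊥-elim (head∉tail u (∈-sublists⁻ b (W⊆ x (here refl))))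
    sublists-canonical {x ∷ xs} u@(_ ∷ u′) W∈ W′∈ W⊆ ⊇W | inj₂ a | inj₂ b with ∈-map⁻ (x ∷_) a | ∈-map⁻ (x ∷_) b
    ...   | W₀ , W₀∈ , refl | W₁ , W₁∈ , refl =
      cong (x ∷_) (sublists-canonical u′ W₀∈ W₁∈ (drop-x W₀∈ W⊆) (drop-x W₁∈ ⊇W))
      where
      drop-x : ∀ {V V′} → V ∈ sublists xs → (∀ w → w ∈ x ∷ V → w ∈ x ∷ V′) → ∀ w → w ∈ V → w ∈ V′
      drop-x V∈ V⊆ w w∈ with V⊆ w (there w∈)
      ... | here refl = ⊥-elim (head∉tail u (∈-sublists⁻ V∈ w∈))
      ... | there w∈′ = w∈′

    filter∈sublists : ∀ {P : A → Set} (P? : Decidable P) xs → filter P? xs ∈ sublists xs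
    filter∈sublists P? []       = here refl
    filter∈sublists P? (x ∷ xs) with does (P? x)
    ... | true  = ∈-++⁺ʳ (sublists xs) (∈-map⁺ (x ∷_) (filter∈sublists P? xs))
    ... | false = ∈-++⁺ˡ (filter∈sublists P? xs)

  module _ {A : Set} {P : A → Set} (P? : Decidable P) (g : A → ℕ) where

    sumOver-indicator-none : ∀ xs → (∀ x → x ∈ xs → ¬ P x) → sumOver xs (λ x → 𝟙 (P? x) * g x) ≡ 0
    sumOver-indicator-none xs ∄x =
      trans (sumOver-cong xs (λ x x∈ → cong (_* g x) (𝟙-no (P? x) (∄x x x∈)))) (sumOver-zero xs)

    sumOver-indicator-unique : ∀ {xs} → Unique xs → ∀ {x₀} → x₀ ∈ xs → P x₀ → (∀ x → P x → x ≡ x₀) →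
                               sumOver xs (λ x → 𝟙 (P? x) * g x) ≡ g x₀
    sumOver-indicator-unique {x ∷ xs} u (here refl) px only
      rewrite 𝟙-yes (P? x) px
            | sumOver-indicator-none xs (λ y y∈ py → head∉tail u (subst (_∈ xs) (only y py) y∈)) =
      trans (ℕₚ.+-identityʳ _) (ℕₚ.*-identityˡ (g x))
    sumOver-indicator-unique {x ∷ xs} u@(_ ∷ u′) (there x₀∈) px₀ only
      rewrite 𝟙-no (P? x) (λ px → head∉tail u (subst (_∈ xs) (sym (only x px)) x₀∈)) =
      sumOver-indicator-unique u′ x₀∈ px₀ only

  module _ {A B C : Set} (f : A → B → C) where

    sumOver-cartesianProductWith : ∀ xs ys (g : C → ℕ) →
      sumOver (cartesianProductWith f xs ys) g ≡ sumOver xs (λ x → sumOver ys (λ y → g (f x y)))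
    sumOver-cartesianProductWith []       ys g = refl
    sumOver-cartesianProductWith (x ∷ xs) ys g = begin
      sumOver (map (f x) ys ++ cartesianProductWith f xs ys) g
        ≡⟨ sumOver-++ (map (f x) ys) _ g ⟩
      sumOver (map (f x) ys) g + sumOver (cartesianProductWith f xs ys) g
        ≡⟨ cong₂ _+_ (sumOver-map (f x) ys g) (sumOver-cartesianProductWith xs ys g) ⟩
      sumOver ys (λ y → g (f x y)) + sumOver xs (λ x → sumOver ys (λ y → g (f x y))) ∎
      where open ≡-Reasoning

  concatMap-map≡cartesianProductWith : ∀ {A B C : Set} (f : A → B → C) xs ys →
    concatMap (λ x → map (f x) ys) xs ≡ cartesianProductWith f xs ys
  concatMap-map≡cartesianProductWith f []       ys = refl
  concatMap-map≡cartesianProductWith f (x ∷ xs) ys =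
    cong (map (f x) ys ++_) (concatMap-map≡cartesianProductWith f xs ys)

  module _ {A : Set} where

    tuplesOf : List A → (r : ℕ) → List (Vec A r)
    tuplesOf xs zero    = Vec.[] ∷ []
    tuplesOf xs (suc r) = cartesianProductWith Vec._∷_ xs (tuplesOf xs r)

    tuplesOf-unique : ∀ {xs} → Unique xs → ∀ r → Unique (tuplesOf xs r)
    tuplesOf-unique u zero    = [] ∷ []
    tuplesOf-unique u (suc r) = Uniqueₚ.cartesianProductWith⁺ Vec._∷_ Vecₚ.∷-injective u (tuplesOf-unique u r)

    ∈-tuplesOf : ∀ {xs} → (∀ x → x ∈ xs) → ∀ {r} (t : Vec A r) → t ∈ tuplesOf xs r
    ∈-tuplesOf complete Vec.[]       = here refl
    ∈-tuplesOf complete (x Vec.∷ t) = ∈-cartesianProductWith⁺ Vec._∷_ (complete x) (∈-tuplesOf complete t)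

    length-tuplesOf : ∀ xs r → length (tuplesOf xs r) ≡ length xs ^ r
    length-tuplesOf xs zero    = refl
    length-tuplesOf xs (suc r) = begin
      length (tuplesOf xs (suc r))                         ≡⟨ sym (sumOver-one (tuplesOf xs (suc r))) ⟩
      sumOver (tuplesOf xs (suc r)) (λ _ → 1)              ≡⟨ sumOver-cartesianProductWith Vec._∷_ xs _ _ ⟩
      sumOver xs (λ _ → sumOver (tuplesOf xs r) (λ _ → 1)) ≡⟨ sumOver-const xs _ ⟩
      length xs * sumOver (tuplesOf xs r) (λ _ → 1)        ≡⟨ cong (length xs *_) (sumOver-one (tuplesOf xs r)) ⟩
      length xs * length (tuplesOf xs r)                   ≡⟨ cong (length xs *_) (length-tuplesOf xs r) ⟩
      length xs * length xs ^ r                            ∎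
      where open ≡-Reasoning

  module _ {A : Set} {P : A → Set} (xs : List A) (complete : ∀ x → x ∈ xs) (P? : Decidable P) where

    Σ-dec : Dec (Σ A P)
    Σ-dec = Dec.map′ (λ p → let (x , _ , px) = find p in x , px)
                     (λ (x , px) → lose (complete x) px)
                     (Any.any? P? xs)

    Π-dec : Dec (∀ x → P x)
    Π-dec = Dec.map′ (λ ps x → All.lookup ps (complete x))
                     (λ f → All.tabulate (λ {x} _ → f x))
                     (All.all? P? xs)

module GaussianBinomials where

  open import Defs using (gauss)
  open import Data.Nat
  open import Data.Nat.Properties
  open import Data.Nat.Tactic.RingSolver using (solve-∀)
  open import Relation.Binary.PropositionalEquality
  open import Data.Sum using (inj₁; inj₂)
  open import Data.Empty using (⊥-elim)
  open import Relation.Nullary using (Dec; yes; no)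

  ^-cancelʳ-≤ : ∀ {m a b} → 1 < m → m ^ a ≤ m ^ b → a ≤ b
  ^-cancelʳ-≤ {m} {a} {b} 1<m mᵃ≤mᵇ with ≤-<-connex a b
  ... | inj₁ a≤b = a≤b
  ... | inj₂ b<a = ⊥-elim (<-irrefl refl (<-≤-trans (^-monoʳ-< m 1<m b<a) mᵃ≤mᵇ))

  ^-injectiveʳ : ∀ {m a b} → 1 < m → m ^ a ≡ m ^ b → a ≡ b
  ^-injectiveʳ 1<m e = ≤-antisym (^-cancelʳ-≤ 1<m (≤-reflexive e)) (^-cancelʳ-≤ 1<m (≤-reflexive (sym e)))

  -- indepTuples q m r counts the independent r-tuples in F_q^m, and extensionTuples q m d r the ways to
  -- extend a fixed independent d-tuple of F_q^m by r further vectors keeping it independent.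
  indepTuples : ℕ → ℕ → ℕ → ℕ
  indepTuples q m zero    = 1
  indepTuples q m (suc r) = indepTuples q m r * (q ^ m ∸ q ^ r)

  extensionTuples : ℕ → ℕ → ℕ → ℕ → ℕ
  extensionTuples q m d zero    = 1
  extensionTuples q m d (suc r) = extensionTuples q m d r * (q ^ m ∸ q ^ (r + d))

  extensionTuples-shift : ∀ q m d r → extensionTuples q (m + d) d r ≡ indepTuples q m r * (q ^ d) ^ r
  extensionTuples-shift q m d zero    = refl
  extensionTuples-shift q m d (suc r) = begin
    extensionTuples q (m + d) d r * (q ^ (m + d) ∸ q ^ (r + d))
      ≡⟨ cong₂ _*_ (extensionTuples-shift q m d r) (cong₂ _∸_ (^-distribˡ-+-* q m d) (^-distribˡ-+-* q r d)) ⟩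
    indepTuples q m r * X ^ r * (q ^ m * X ∸ q ^ r * X)
      ≡⟨ cong (indepTuples q m r * X ^ r *_) (sym (*-distribʳ-∸ X (q ^ m) (q ^ r))) ⟩
    indepTuples q m r * X ^ r * ((q ^ m ∸ q ^ r) * X)
      ≡⟨ solve (indepTuples q m r) (X ^ r) (q ^ m ∸ q ^ r) X ⟩
    indepTuples q m r * (q ^ m ∸ q ^ r) * (X * X ^ r) ∎
    where
    open ≡-Reasoning
    X : ℕ
    X = q ^ d
    solve : ∀ a b c x → a * b * (c * x) ≡ a * c * (x * b)
    solve = solve-∀

  indepTuples-> : ∀ q m r → m < r → indepTuples q m r ≡ 0
  indepTuples-> q m (suc r) m<r with m≤n⇒m<n∨m≡n (≤-pred m<r)
  ... | inj₁ m<r′ rewrite indepTuples-> q m r m<r′ = refl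
  ... | inj₂ refl rewrite n∸n≡0 (q ^ m) = *-zeroʳ (indepTuples q m m)

  indepTuples-suc : ∀ q m r → indepTuples q (suc m) (suc r) ≡ (q ^ suc m ∸ 1) * q ^ r * indepTuples q m r
  indepTuples-suc q m zero = solve (q * q ^ m ∸ 1)
    where
    solve : ∀ a → 1 * a ≡ a * 1 * 1
    solve = solve-∀
  indepTuples-suc q m (suc r) = begin
    indepTuples q (suc m) (suc r) * (q * q ^ m ∸ q * q ^ r)
      ≡⟨ cong₂ _*_ (indepTuples-suc q m r) (sym (*-distribˡ-∸ q (q ^ m) (q ^ r))) ⟩
    (q * q ^ m ∸ 1) * q ^ r * indepTuples q m r * (q * (q ^ m ∸ q ^ r))
      ≡⟨ solve (q * q ^ m ∸ 1) (q ^ r) (indepTuples q m r) q (q ^ m ∸ q ^ r) ⟩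
    (q * q ^ m ∸ 1) * (q * q ^ r) * (indepTuples q m r * (q ^ m ∸ q ^ r)) ∎
    where
    open ≡-Reasoning
    solve : ∀ a b c x y → a * b * c * (x * y) ≡ a * (x * b) * (c * y)
    solve = solve-∀

  indepTuples-pos : ∀ q → 1 < q → ∀ r → 0 < indepTuples q r r
  indepTuples-pos q 1<q zero    = s≤s z≤n
  indepTuples-pos q@(suc _) 1<q (suc r) rewrite indepTuples-suc q r r =
    *-mono-≤ (*-mono-≤ (∸-monoˡ-< (^-monoʳ-< q 1<q {0} {suc r} (s≤s z≤n)) ≤-refl) (m^n>0 q r))
             (indepTuples-pos q 1<q r)

  ∸-chain : ∀ {a b c} → a ≤ b → b ≤ c → (b ∸ a) + (c ∸ b) ≡ c ∸ a
  ∸-chain {a} {b} {c} a≤b b≤c =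
    trans (+-comm (b ∸ a) _) (trans (sym (+-∸-assoc (c ∸ b) a≤b)) (cong (_∸ a) (m∸n+n≡m b≤c)))

  gauss*indepTuples : ∀ q .{{_ : NonZero q}} m r → gauss q m r * indepTuples q r r ≡ indepTuples q m r
  gauss*indepTuples q m       zero    = refl
  gauss*indepTuples q zero    (suc r) = sym (indepTuples-> q 0 (suc r) (s≤s z≤n))
  gauss*indepTuples q (suc m) (suc r) = begin
    (g₁ + q ^ suc r * g₂) * indepTuples q (suc r) (suc r)
      ≡⟨ cong ((g₁ + q ^ suc r * g₂) *_) (indepTuples-suc q r r) ⟩
    (g₁ + q ^ suc r * g₂) * (A * q ^ r * indepTuples q r r)
      ≡⟨ solve₁ g₁ (q ^ suc r) g₂ A (q ^ r) (indepTuples q r r) ⟩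
    A * q ^ r * (g₁ * indepTuples q r r) + q ^ suc r * (g₂ * (A * q ^ r * indepTuples q r r))
      ≡⟨ cong₂ (λ u v → A * q ^ r * u + q ^ suc r * (g₂ * v)) (gauss*indepTuples q m r) (sym (indepTuples-suc q r r)) ⟩
    A * q ^ r * indepTuples q m r + q ^ suc r * (g₂ * indepTuples q (suc r) (suc r))
      ≡⟨ cong (λ u → A * q ^ r * indepTuples q m r + q ^ suc r * u) (gauss*indepTuples q m (suc r)) ⟩
    A * q ^ r * indepTuples q m r + q ^ suc r * (indepTuples q m r * (q ^ m ∸ q ^ r))
      ≡⟨ solve₂ A (q ^ r) (indepTuples q m r) q (q ^ m ∸ q ^ r) ⟩
    q ^ r * indepTuples q m r * (A + q * (q ^ m ∸ q ^ r))
      ≡⟨ telescope ⟩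
    (q ^ suc m ∸ 1) * q ^ r * indepTuples q m r
      ≡⟨ sym (indepTuples-suc q m r) ⟩
    indepTuples q (suc m) (suc r) ∎
    where
    open ≡-Reasoning
    g₁ : ℕ
    g₁ = gauss q m r
    g₂ : ℕ
    g₂ = gauss q m (suc r)
    A : ℕ
    A = q ^ suc r ∸ 1
    solve₁ : ∀ g₁ Q g₂ a b c → (g₁ + Q * g₂) * (a * b * c) ≡ a * b * (g₁ * c) + Q * (g₂ * (a * b * c))
    solve₁ = solve-∀
    solve₂ : ∀ a b c x y → a * b * c + x * b * (c * y) ≡ b * c * (a + x * y)
    solve₂ = solve-∀
    telescope : q ^ r * indepTuples q m r * (A + q * (q ^ m ∸ q ^ r)) ≡ (q ^ suc m ∸ 1) * q ^ r * indepTuples q m r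
    telescope with ≤-<-connex r m
    ... | inj₂ m<r rewrite indepTuples-> q m r m<r | *-zeroʳ (q ^ r) | *-zeroʳ ((q ^ suc m ∸ 1) * q ^ r) = refl
    ... | inj₁ r≤m = begin
      q ^ r * indepTuples q m r * (A + q * (q ^ m ∸ q ^ r))
        ≡⟨ cong (λ u → q ^ r * indepTuples q m r * (A + u)) (*-distribˡ-∸ q (q ^ m) (q ^ r)) ⟩
      q ^ r * indepTuples q m r * (A + (q ^ suc m ∸ q ^ suc r))
        ≡⟨ cong (q ^ r * indepTuples q m r *_) (∸-chain (m^n>0 q (suc r)) (^-monoʳ-≤ q (s≤s r≤m))) ⟩
      q ^ r * indepTuples q m r * (q ^ suc m ∸ 1)
        ≡⟨ solve₃ (q ^ r) (indepTuples q m r) (q ^ suc m ∸ 1) ⟩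
      (q ^ suc m ∸ 1) * q ^ r * indepTuples q m r ∎
      where
      solve₃ : ∀ a b c → a * b * c ≡ c * a * b
      solve₃ = solve-∀

  gauss-< : ∀ q m r → m < r → gauss q m r ≡ 0
  gauss-< q zero    (suc r) _ = refl
  gauss-< q (suc m) (suc r) (s≤s m<r)
    rewrite gauss-< q m r m<r | gauss-< q m (suc r) (m<n⇒m<1+n m<r) = *-zeroʳ (q ^ suc r)

  gauss-diagonal : ∀ q r → gauss q r r ≡ 1
  gauss-diagonal q zero    = refl
  gauss-diagonal q (suc r) rewrite gauss-diagonal q r | gauss-< q r (suc r) (n<1+n r) | *-zeroʳ (q ^ suc r) = refl

  superspaceCount : (q n a d : ℕ) → Dec (d ≤ a) → ℕ
  superspaceCount q n a d (yes _) = gauss q (n ∸ d) (a ∸ d)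
  superspaceCount q n a d (no _)  = 0

  superspaceCount-≤ : ∀ q n {a d} → d ≤ a → (d≤a? : Dec (d ≤ a)) →
                      superspaceCount q n a d d≤a? ≡ gauss q (n ∸ d) (a ∸ d)
  superspaceCount-≤ q n d≤a (yes _)  = refl
  superspaceCount-≤ q n d≤a (no d≰a) = ⊥-elim (d≰a d≤a)

module LinearAlgebra (F : FiniteField) where

  open Counting
  open Enumeration
  open GaussianBinomials using (^-cancelʳ-≤; ^-injectiveʳ)
  open import Data.Nat as ℕ using (ℕ; zero; suc; _^_; _≤_; _<_; z≤n; s≤s)
  import Data.Nat.Properties as ℕₚ
  open import Data.List as List using (List; length)
  open import Data.List.Membership.Propositional using (_∈_)
  open import Data.List.Relation.Unary.Unique.Propositional using (Unique)
  open import Data.Vec as Vec using (Vec; []; _∷_; _++_)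
  import Data.Vec.Properties as Vecₚ
  open import Data.Vec.Relation.Unary.All as VAll using ([]; _∷_)
  open import Data.Product using (Σ; _×_; _,_; proj₁; proj₂)
  open import Data.Unit using (tt)
  open import Data.Empty using (⊥-elim)
  open import Relation.Nullary using (Dec; yes; no; ¬_)
  open import Relation.Nullary.Decidable using (_×-dec_; ¬?; decidable-stable)
  open import Relation.Unary using (Decidable)
  open import Relation.Binary.Definitions using (DecidableEquality)
  open import Relation.Binary.PropositionalEquality
  open import Algebra.Structures using (IsCommutativeRing)

  open FiniteField F
  module R = IsCommutativeRing isCommutativeRing

  infixl 6 _⊕_
  infixr 7 _·_

  _⊕_ : ∀ {n} → V F n → V F n → V F n
  _⊕_ = Defs._⊕_ F

  _·_ : ∀ {n} → Carrier → V F n → V F n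
  _·_ = Defs._·_ F

  0v : ∀ {n} → V F n
  0v = Defs.0v F

  lincomb : ∀ {n d} → Vec Carrier d → Vec (V F n) d → V F n
  lincomb = Defs.lincomb F

  LinIndep : ∀ {n d} → Vec (V F n) d → Set
  LinIndep = Defs.LinIndep F

  HasDim : ∀ {n} → (V F n → Set) → ℕ → Set
  HasDim = Defs.HasDim F

  allVecs : ∀ n → List (V F n)
  allVecs = Defs.allVecs F

  ⊕-assoc : ∀ {n} (u v w : V F n) → (u ⊕ v) ⊕ w ≡ u ⊕ (v ⊕ w)
  ⊕-assoc = Vecₚ.zipWith-assoc R.+-assoc

  ⊕-comm : ∀ {n} (u v : V F n) → u ⊕ v ≡ v ⊕ u
  ⊕-comm = Vecₚ.zipWith-comm R.+-comm

  ⊕-identityˡ : ∀ {n} (v : V F n) → 0v ⊕ v ≡ v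
  ⊕-identityˡ = Vecₚ.zipWith-identityˡ R.+-identityˡ

  ⊕-identityʳ : ∀ {n} (v : V F n) → v ⊕ 0v ≡ v
  ⊕-identityʳ = Vecₚ.zipWith-identityʳ R.+-identityʳ

  ⊕-interchange : ∀ {n} (a b c d : V F n) → (a ⊕ b) ⊕ (c ⊕ d) ≡ (a ⊕ c) ⊕ (b ⊕ d)
  ⊕-interchange a b c d = begin
    (a ⊕ b) ⊕ (c ⊕ d) ≡⟨ ⊕-assoc a b _ ⟩
    a ⊕ (b ⊕ (c ⊕ d)) ≡⟨ cong (a ⊕_) (sym (⊕-assoc b c d)) ⟩
    a ⊕ ((b ⊕ c) ⊕ d) ≡⟨ cong (λ z → a ⊕ (z ⊕ d)) (⊕-comm b c) ⟩
    a ⊕ ((c ⊕ b) ⊕ d) ≡⟨ cong (a ⊕_) (⊕-assoc c b d) ⟩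
    a ⊕ (c ⊕ (b ⊕ d)) ≡⟨ sym (⊕-assoc a c _) ⟩
    (a ⊕ c) ⊕ (b ⊕ d) ∎
    where open ≡-Reasoning

  ·-distribˡ-⊕ : ∀ {n} c (u v : V F n) → c · (u ⊕ v) ≡ c · u ⊕ c · v
  ·-distribˡ-⊕ c []      []      = refl
  ·-distribˡ-⊕ c (a ∷ u) (b ∷ v) = cong₂ _∷_ (R.distribˡ c a b) (·-distribˡ-⊕ c u v)

  ·-distribʳ-+ : ∀ {n} c d (v : V F n) → (c + d) · v ≡ c · v ⊕ d · v
  ·-distribʳ-+ c d []      = refl
  ·-distribʳ-+ c d (a ∷ v) = cong₂ _∷_ (R.distribʳ a c d) (·-distribʳ-+ c d v)

  ·-assoc : ∀ {n} c d (v : V F n) → (c * d) · v ≡ c · d · v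
  ·-assoc c d []      = refl
  ·-assoc c d (a ∷ v) = cong₂ _∷_ (R.*-assoc c d a) (·-assoc c d v)

  ·-identityˡ : ∀ {n} (v : V F n) → 1# · v ≡ v
  ·-identityˡ []      = refl
  ·-identityˡ (a ∷ v) = cong₂ _∷_ (R.*-identityˡ a) (·-identityˡ v)

  ·-zeroˡ : ∀ {n} (v : V F n) → 0# · v ≡ 0v
  ·-zeroˡ []      = refl
  ·-zeroˡ (a ∷ v) = cong₂ _∷_ (R.zeroˡ a) (·-zeroˡ v)

  ·-zeroʳ : ∀ {n} c → c · 0v {n} ≡ 0v
  ·-zeroʳ {zero}  c = refl
  ·-zeroʳ {suc n} c = cong₂ _∷_ (R.zeroʳ c) (·-zeroʳ c)

  -1*x+x≡0 : ∀ x → ((- 1#) * x) + x ≡ 0#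
  -1*x+x≡0 x = begin
    ((- 1#) * x) + x        ≡⟨ cong (((- 1#) * x) +_) (sym (R.*-identityˡ x)) ⟩
    ((- 1#) * x) + (1# * x) ≡⟨ sym (R.distribʳ x (- 1#) 1#) ⟩
    ((- 1#) + 1#) * x       ≡⟨ cong (_* x) (R.-‿inverseˡ 1#) ⟩
    0# * x                  ≡⟨ R.zeroˡ x ⟩
    0#                      ∎
    where open ≡-Reasoning

  -1*-1≡1 : (- 1#) * (- 1#) ≡ 1#
  -1*-1≡1 = begin
    (- 1#) * (- 1#)                                ≡⟨ sym (R.+-identityʳ _) ⟩
    ((- 1#) * (- 1#)) + 0#                         ≡⟨ cong (((- 1#) * (- 1#)) +_) (sym (-1*x+x≡0 1#)) ⟩
    ((- 1#) * (- 1#)) + (((- 1#) * 1#) + 1#)       ≡⟨ sym (R.+-assoc _ _ _) ⟩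
    (((- 1#) * (- 1#)) + ((- 1#) * 1#)) + 1#       ≡⟨ cong (_+ 1#) (sym (R.distribˡ (- 1#) (- 1#) 1#)) ⟩
    ((- 1#) * ((- 1#) + 1#)) + 1#                  ≡⟨ cong (λ z → ((- 1#) * z) + 1#) (R.-‿inverseˡ 1#) ⟩
    ((- 1#) * 0#) + 1#                             ≡⟨ cong (_+ 1#) (R.zeroʳ _) ⟩
    0# + 1#                                        ≡⟨ R.+-identityˡ 1# ⟩
    1#                                             ∎
    where open ≡-Reasoning

  ⊕-inverseˡ : ∀ {n} (v : V F n) → (- 1#) · v ⊕ v ≡ 0v
  ⊕-inverseˡ []      = refl
  ⊕-inverseˡ (a ∷ v) = cong₂ _∷_ (-1*x+x≡0 a) (⊕-inverseˡ v)

  ⊕-inverseʳ : ∀ {n} (v : V F n) → v ⊕ (- 1#) · v ≡ 0v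
  ⊕-inverseʳ v = trans (⊕-comm v _) (⊕-inverseˡ v)

  u-v≡0⇒u≡v : ∀ {n} (u v : V F n) → u ⊕ (- 1#) · v ≡ 0v → u ≡ v
  u-v≡0⇒u≡v u v e = begin
    u                          ≡⟨ sym (⊕-identityʳ u) ⟩
    u ⊕ 0v                     ≡⟨ cong (u ⊕_) (sym (⊕-inverseˡ v)) ⟩
    u ⊕ ((- 1#) · v ⊕ v)       ≡⟨ sym (⊕-assoc u _ v) ⟩
    (u ⊕ (- 1#) · v) ⊕ v       ≡⟨ cong (_⊕ v) e ⟩
    0v ⊕ v                     ≡⟨ ⊕-identityˡ v ⟩
    v                          ∎
    where open ≡-Reasoning

  u+v≡0⇒u≡-v : ∀ {n} (u v : V F n) → u ⊕ v ≡ 0v → u ≡ (- 1#) · v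
  u+v≡0⇒u≡-v u v e = u-v≡0⇒u≡v u ((- 1#) · v) (begin
    u ⊕ (- 1#) · (- 1#) · v    ≡⟨ cong (u ⊕_) (sym (·-assoc (- 1#) (- 1#) v)) ⟩
    u ⊕ ((- 1#) * (- 1#)) · v  ≡⟨ cong (λ z → u ⊕ z · v) -1*-1≡1 ⟩
    u ⊕ 1# · v                 ≡⟨ cong (u ⊕_) (·-identityˡ v) ⟩
    u ⊕ v                      ≡⟨ e ⟩
    0v                         ∎)
    where open ≡-Reasoning

  0v++0v : ∀ k l → 0v {k} ++ 0v {l} ≡ 0v
  0v++0v zero    l = refl
  0v++0v (suc k) l = cong (0# ∷_) (0v++0v k l)

  lincomb-0 : ∀ {n d} (B : Vec (V F n) d) → lincomb 0v B ≡ 0v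
  lincomb-0 []      = refl
  lincomb-0 (b ∷ B) = trans (cong₂ _⊕_ (·-zeroˡ b) (lincomb-0 B)) (⊕-identityˡ 0v)

  lincomb-⊕ : ∀ {n d} (c c′ : Vec Carrier d) (B : Vec (V F n) d) →
              lincomb (c ⊕ c′) B ≡ lincomb c B ⊕ lincomb c′ B
  lincomb-⊕ []      []        []      = sym (⊕-identityˡ 0v)
  lincomb-⊕ (a ∷ c) (a′ ∷ c′) (b ∷ B) = begin
    (a + a′) · b ⊕ lincomb (c ⊕ c′) B       ≡⟨ cong₂ _⊕_ (·-distribʳ-+ a a′ b) (lincomb-⊕ c c′ B) ⟩
    (a · b ⊕ a′ · b) ⊕ (lincomb c B ⊕ lincomb c′ B)  ≡⟨ ⊕-interchange _ _ _ _ ⟩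
    (a · b ⊕ lincomb c B) ⊕ (a′ · b ⊕ lincomb c′ B)  ∎
    where open ≡-Reasoning

  lincomb-· : ∀ {n d} k (c : Vec Carrier d) (B : Vec (V F n) d) → lincomb (k · c) B ≡ k · lincomb c B
  lincomb-· k []      []      = sym (·-zeroʳ k)
  lincomb-· k (a ∷ c) (b ∷ B) = trans (cong₂ _⊕_ (·-assoc k a b) (lincomb-· k c B)) (sym (·-distribˡ-⊕ k _ _))

  lincomb-++ : ∀ {n d e} (c : Vec Carrier d) (c′ : Vec Carrier e) (B : Vec (V F n) d) (B′ : Vec (V F n) e) →
               lincomb (c ++ c′) (B ++ B′) ≡ lincomb c B ⊕ lincomb c′ B′
  lincomb-++ []      c′ []      B′ = sym (⊕-identityˡ _)
  lincomb-++ (a ∷ c) c′ (b ∷ B) B′ = trans (cong (a · b ⊕_) (lincomb-++ c c′ B B′)) (sym (⊕-assoc _ _ _))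

  module _ {n} {T : V F n → V F n} (linear : IsLinear F T) where

    linear-0 : T 0v ≡ 0v
    linear-0 = begin
      T 0v         ≡⟨ cong T (sym (·-zeroˡ 0v)) ⟩
      T (0# · 0v)  ≡⟨ proj₂ linear 0# 0v ⟩
      0# · T 0v    ≡⟨ ·-zeroˡ _ ⟩
      0v           ∎
      where open ≡-Reasoning

    linear-lincomb : ∀ {d} (c : Vec Carrier d) (B : Vec (V F n) d) → T (lincomb c B) ≡ lincomb c (Vec.map T B)
    linear-lincomb []      []      = linear-0
    linear-lincomb (a ∷ c) (b ∷ B) =
      trans (proj₁ linear _ _) (cong₂ _⊕_ (proj₂ linear a b) (linear-lincomb c B))

  record Subspace {n} (P : V F n → Set) : Set where
    field
      0∈ : P 0v
      ⊕∈ : ∀ {u v} → P u → P v → P (u ⊕ v)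
      ·∈ : ∀ c {v} → P v → P (c · v)

    lincomb∈ : ∀ {d} {B : Vec (V F n) d} → VAll.All P B → ∀ c → P (lincomb c B)
    lincomb∈ []        []      = 0∈
    lincomb∈ (pb ∷ pB) (a ∷ c) = ⊕∈ (·∈ a pb) (lincomb∈ pB c)

  open Subspace public

  InSpan : ∀ {n d} → Vec (V F n) d → V F n → Set
  InSpan {d = d} B w = Σ (Vec Carrier d) (λ c → lincomb c B ≡ w)

  span-subspace : ∀ {n d} (B : Vec (V F n) d) → Subspace (InSpan B)
  span-subspace B = record
    { 0∈ = 0v , lincomb-0 B
    ; ⊕∈ = λ { (c , refl) (c′ , refl) → c ⊕ c′ , lincomb-⊕ c c′ B }
    ; ·∈ = λ { k (c , refl) → k · c , lincomb-· k c B }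
    }

  span-⊇ : ∀ {n d} (B : Vec (V F n) d) → VAll.All (InSpan B) B
  span-⊇ []      = []
  span-⊇ (b ∷ B) =
    (1# ∷ 0v , trans (cong₂ _⊕_ (·-identityˡ b) (lincomb-0 B)) (⊕-identityʳ b))
    ∷ VAll.map (λ { {w} (c , e) → 0# ∷ c , trans (cong₂ _⊕_ (·-zeroˡ b) e) (⊕-identityˡ w) }) (span-⊇ B)

  span-least : ∀ {n d} {P : V F n → Set} → Subspace P → {B : Vec (V F n) d} → VAll.All P B →
               ∀ {w} → InSpan B w → P w
  span-least S pB (c , refl) = lincomb∈ S pB c

  _≟ᵥ_ : ∀ {n} → DecidableEquality (V F n)
  _≟ᵥ_ = Vecₚ.≡-dec _≟_

  allVecs≡tuplesOf : ∀ n → allVecs n ≡ tuplesOf elements n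
  allVecs≡tuplesOf zero    = refl
  allVecs≡tuplesOf (suc n) rewrite allVecs≡tuplesOf n =
    concatMap-map≡cartesianProductWith Vec._∷_ elements (tuplesOf elements n)

  allVecs-unique : ∀ n → Unique (allVecs n)
  allVecs-unique n rewrite allVecs≡tuplesOf n = tuplesOf-unique elements-unique n

  ∈-allVecs : ∀ {n} (v : V F n) → v ∈ allVecs n
  ∈-allVecs {n} v rewrite allVecs≡tuplesOf n = ∈-tuplesOf elements-complete v

  length-allVecs : ∀ n → length (allVecs n) ≡ q ^ n
  length-allVecs n rewrite allVecs≡tuplesOf n = length-tuplesOf elements n

  1<q : 1 < q
  1<q = subst₂ _<_ (count-unique (_≟ 0#) elements-unique (elements-complete 0#) refl (λ _ _ e → e))
                   (count-all (λ _ → yes tt) elements (λ _ _ → tt))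
          (count-mono-< (_≟ 0#) (λ _ → yes tt) elements (λ _ _ _ → tt)
                        1# (elements-complete 1#) tt (λ 1≡0 → 0≢1 (sym 1≡0)))

  instance
    q-nonZero : ℕ.NonZero q
    q-nonZero = ℕ.>-nonZero (ℕₚ.<-trans (s≤s z≤n) 1<q)

  size : ∀ {n} {P : V F n → Set} → Decidable P → ℕ
  size {n} P? = count P? (allVecs n)

  size≤q^n : ∀ {n} {P : V F n → Set} (P? : Decidable P) → size P? ≤ q ^ n
  size≤q^n {n} P? = subst (size P? ≤_) (length-allVecs n) (count≤length P? (allVecs n))

  size-mono : ∀ {n} {P Q : V F n → Set} (P? : Decidable P) (Q? : Decidable Q) → (∀ x → P x → Q x) →
              size P? ≤ size Q?
  size-mono {n} P? Q? P⊆Q = count-mono P? Q? (allVecs n) (λ y _ → P⊆Q y)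

  ⊆-size-≡⇒⊇ : ∀ {n} {P Q : V F n → Set} (P? : Decidable P) (Q? : Decidable Q) →
               (∀ x → P x → Q x) → size P? ≡ size Q? → ∀ x → Q x → P x
  ⊆-size-≡⇒⊇ {n} P? Q? P⊆Q e x qx with P? x
  ... | yes px = px
  ... | no ¬px = ⊥-elim (ℕₚ.<-irrefl e (count-mono-< P? Q? (allVecs n) (λ y _ → P⊆Q y) x (∈-allVecs x) qx ¬px))

  inSpan? : ∀ {n d} (B : Vec (V F n) d) → Decidable (InSpan B)
  inSpan? {d = d} B w = Σ-dec (allVecs d) ∈-allVecs (λ c → lincomb c B ≟ᵥ w)

  lincomb-injective : ∀ {n d} {B : Vec (V F n) d} → LinIndep B → ∀ c c′ → lincomb c B ≡ lincomb c′ B → c ≡ c′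
  lincomb-injective {B = B} indep c c′ e = u-v≡0⇒u≡v c c′ (indep _ (begin
    lincomb (c ⊕ (- 1#) · c′) B          ≡⟨ lincomb-⊕ c _ B ⟩
    lincomb c B ⊕ lincomb ((- 1#) · c′) B ≡⟨ cong (lincomb c B ⊕_) (lincomb-· (- 1#) c′ B) ⟩
    lincomb c B ⊕ (- 1#) · lincomb c′ B   ≡⟨ cong (λ z → lincomb c B ⊕ (- 1#) · z) (sym e) ⟩
    lincomb c B ⊕ (- 1#) · lincomb c B    ≡⟨ ⊕-inverseʳ (lincomb c B) ⟩
    0v                                    ∎))
    where open ≡-Reasoning

  []-indep : ∀ {n} → LinIndep (Vec.[] {A = V F n})
  []-indep [] _ = refl

  ∷-indep : ∀ {n d} {B : Vec (V F n) d} {v} → LinIndep B → ¬ InSpan B v → LinIndep (v ∷ B)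
  ∷-indep {B = B} {v} indep v∉B (a ∷ c) e with a ≟ 0#
  ... | yes refl = cong (0# ∷_) (indep c (begin
    lincomb c B           ≡⟨ sym (⊕-identityˡ _) ⟩
    0v ⊕ lincomb c B      ≡⟨ cong (_⊕ lincomb c B) (sym (·-zeroˡ v)) ⟩
    0# · v ⊕ lincomb c B  ≡⟨ e ⟩
    0v                    ∎))
    where open ≡-Reasoning
  ... | no a≢0 with inverse a a≢0
  ...   | a⁻¹ , aa⁻¹≡1 = ⊥-elim (v∉B (a⁻¹ · (- 1#) · c , (begin
    lincomb (a⁻¹ · (- 1#) · c) B   ≡⟨ lincomb-· a⁻¹ ((- 1#) · c) B ⟩
    a⁻¹ · lincomb ((- 1#) · c) B   ≡⟨ cong (a⁻¹ ·_) (lincomb-· (- 1#) c B) ⟩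
    a⁻¹ · (- 1#) · lincomb c B     ≡⟨ cong (a⁻¹ ·_) (sym (u+v≡0⇒u≡-v _ _ e)) ⟩
    a⁻¹ · a · v                    ≡⟨ sym (·-assoc a⁻¹ a v) ⟩
    (a⁻¹ * a) · v                  ≡⟨ cong (_· v) (trans (R.*-comm a⁻¹ a) aa⁻¹≡1) ⟩
    1# · v                         ≡⟨ ·-identityˡ v ⟩
    v                              ∎)))
    where open ≡-Reasoning

  size-span : ∀ {n d} (B : Vec (V F n) d) → LinIndep B → size (inSpan? B) ≡ q ^ d
  size-span {n} {d} B indep = begin
    count (inSpan? B) (allVecs n)
      ≡⟨ sumOver-cong (allVecs n) (λ w _ → preimages w (inSpan? B w)) ⟩
    sumOver (allVecs n) (λ w → count (λ c → lincomb c B ≟ᵥ w) (allVecs d))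
      ≡⟨ sumOver-swap (allVecs n) (allVecs d) _ ⟩
    sumOver (allVecs d) (λ c → count (lincomb c B ≟ᵥ_) (allVecs n))
      ≡⟨ sumOver-cong (allVecs d) (λ c _ → image c) ⟩
    sumOver (allVecs d) (λ _ → 1)
      ≡⟨ sumOver-one (allVecs d) ⟩
    length (allVecs d)
      ≡⟨ length-allVecs d ⟩
    q ^ d ∎
    where
    open ≡-Reasoning
    image : ∀ c → count (lincomb c B ≟ᵥ_) (allVecs n) ≡ 1
    image c = count-unique (lincomb c B ≟ᵥ_) (allVecs-unique n) (∈-allVecs _) refl (λ _ _ e → sym e)
    preimages : ∀ w (w∈? : Dec (InSpan B w)) → 𝟙 w∈? ≡ count (λ c → lincomb c B ≟ᵥ w) (allVecs d)
    preimages w (yes (c , e)) = sym (count-unique (λ c → lincomb c B ≟ᵥ w) (allVecs-unique d) (∈-allVecs c) e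
                                       (λ c′ _ e′ → lincomb-injective indep c′ c (trans e′ (sym e))))
    preimages w (no w∉B) = sym (count-none (λ c → lincomb c B ≟ᵥ w) (allVecs d) (λ c _ e → w∉B (c , e)))

  indep⇒length≤ : ∀ {n d} (B : Vec (V F n) d) → LinIndep B → d ≤ n
  indep⇒length≤ B indep = ^-cancelʳ-≤ 1<q (subst (_≤ _) (size-span B indep) (size≤q^n (inSpan? B)))

  size-hasDim : ∀ {n d} {P : V F n → Set} (P? : Decidable P) → Subspace P → HasDim P d → size P? ≡ q ^ d
  size-hasDim {n} P? S (B , B⊆P , indep , spans) =
    trans (count-cong P? (inSpan? B) (allVecs n) (λ w _ pw → spans w pw) (λ w _ → span-least S B⊆P))
          (size-span B indep)

  record Extension {n k} (P : V F n → Set) (B : Vec (V F n) k) : Set where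
    constructor extension
    field
      {e}   : ℕ
      E     : Vec (V F n) e
      indep : LinIndep (E ++ B)
      ⊆P    : VAll.All P (E ++ B)
      spans : ∀ w → P w → InSpan (E ++ B) w

    hasDim : HasDim P (e ℕ.+ k)
    hasDim = E ++ B , ⊆P , indep , spans

  module _ {n k} {P : V F n → Set} (P? : Decidable P) (B : Vec (V F n) k) where

    -- The fuel bounds the number of vectors that can still be added: an independent family has at most n members.
    extend : ∀ fuel {e} (E : Vec (V F n) e) → LinIndep (E ++ B) → VAll.All P (E ++ B) →
             n ≤ e ℕ.+ k ℕ.+ fuel → Extension P B
    extend fuel E indep ⊆P n≤ with Σ-dec (allVecs n) ∈-allVecs (λ w → P? w ×-dec ¬? (inSpan? (E ++ B) w))
    ... | no ∄w = extension E indep ⊆P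
                    (λ w pw → decidable-stable (inSpan? (E ++ B) w) (λ w∉ → ∄w (w , pw , w∉)))
    ... | yes (w , pw , w∉) with fuel
    ...   | zero     = ⊥-elim (ℕₚ.<-irrefl refl (ℕₚ.<-≤-trans
                         (s≤s (ℕₚ.≤-trans n≤ (ℕₚ.≤-reflexive (ℕₚ.+-identityʳ _))))
                         (indep⇒length≤ (w ∷ (E ++ B)) (∷-indep indep w∉))))
    ...   | suc fuel = extend fuel (w ∷ E) (∷-indep indep w∉) (pw ∷ ⊆P)
                         (ℕₚ.≤-trans n≤ (ℕₚ.≤-reflexive (ℕₚ.+-suc _ fuel)))

  -- Opaque: only the existence of a basis matters, and unfolding the exhaustive search in types is intractable.
  opaque
    basis-extension : ∀ {n k} {P : V F n → Set} (P? : Decidable P) (B : Vec (V F n) k) →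
                      LinIndep B → VAll.All P B → Extension P B
    basis-extension {n} P? B indep B⊆P = extend P? B n [] indep B⊆P (ℕₚ.m≤n+m n _)

    dimension : ∀ {n} {P : V F n → Set} → Decidable P → Σ ℕ (HasDim P)
    dimension P? = _ , Extension.hasDim (basis-extension P? [] []-indep [])

  size⇒hasDim : ∀ {n d} {P : V F n → Set} (P? : Decidable P) → Subspace P → size P? ≡ q ^ d → HasDim P d
  size⇒hasDim P? S e with dimension P?
  ... | d′ , hasDim = subst (HasDim _) (^-injectiveʳ 1<q (trans (sym (size-hasDim P? S hasDim)) e)) hasDim

  indep⇒length≤dim : ∀ {n d e} {B : Vec (V F n) d} {P : V F n → Set} (P? : Decidable P) → Subspace P →
                     size P? ≡ q ^ e → LinIndep B → VAll.All P B → d ≤ e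
  indep⇒length≤dim {B = B} P? S P-size indep B⊆P =
    ^-cancelʳ-≤ 1<q (subst₂ _≤_ (size-span B indep) P-size (size-mono (inSpan? B) P? (λ _ → span-least S B⊆P)))

module SubspaceCounting (F : FiniteField) (n : ℕ) where

  open Counting
  open Enumeration
  open GaussianBinomials
  open import Defs using (IsSubspace; sublists; gauss)
  open import Data.Nat as ℕ using (ℕ; zero; suc; _+_; _*_; _^_; _∸_; _≤_; _<_)
  import Data.Nat.Properties as ℕₚ
  open import Data.List as List using (List; filter)
  open import Data.List.Membership.Propositional using (_∈_)
  open import Data.List.Membership.Propositional.Properties using (∈-filter⁺; ∈-filter⁻)
  open import Data.List.Relation.Unary.All as All using ()
  open import Data.List.Relation.Unary.Unique.Propositional using (Unique)
  open import Data.Vec as Vec using (Vec; []; _∷_; _++_)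
  open import Data.Vec.Relation.Unary.All as VAll using ([]; _∷_)
  import Data.Vec.Relation.Unary.All.Properties as VAllₚ
  open import Data.Product using (_×_; _,_; proj₂)
  open import Data.Unit using (⊤; tt)
  open import Relation.Nullary using (Dec; yes; no; ¬_)
  open import Relation.Nullary.Decidable using (_×-dec_; ¬?; _→-dec_)
  open import Relation.Unary using (Decidable)
  open import Relation.Binary.PropositionalEquality

  open FiniteField F using (q; elements; elements-complete)
  open LinearAlgebra F

  Vn : Set
  Vn = V F n

  open import Data.List.Membership.DecPropositional (_≟ᵥ_ {n}) public using (_∈?_)

  isSubspace? : ∀ X → Dec (IsSubspace F X)
  isSubspace? X =
    (0v ∈? X) ×-dec
    Π-dec (allVecs n) ∈-allVecs (λ u → Π-dec (allVecs n) ∈-allVecs (λ v →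
      (u ∈? X) →-dec ((v ∈? X) →-dec ((u ⊕ v) ∈? X)))) ×-dec
    Π-dec elements elements-complete (λ c → Π-dec (allVecs n) ∈-allVecs (λ v →
      (v ∈? X) →-dec ((c · v) ∈? X)))

  subspace : ∀ {X : List Vn} → IsSubspace F X → Subspace (_∈ X)
  subspace (0∈X , ⊕∈X , ·∈X) = record { 0∈ = 0∈X ; ⊕∈ = ⊕∈X _ _ ; ·∈ = λ c → ·∈X c _ }

  -- The dimension is read off the cardinality |X| = q ^ e, which (unlike HasDim) is decidable.
  SubspaceOfDim : ℕ → List Vn → Set
  SubspaceOfDim e X = IsSubspace F X × size (_∈? X) ≡ q ^ e

  subspaceOfDim? : ∀ e → Decidable (SubspaceOfDim e)
  subspaceOfDim? e X = isSubspace? X ×-dec (size (_∈? X) ℕ.≟ q ^ e)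

  subsets : List (List Vn)
  subsets = sublists (allVecs n)

  subsets-unique : Unique subsets
  subsets-unique = sublists-unique (allVecs-unique n)

  tuples : ∀ r → List (Vec Vn r)
  tuples = tuplesOf (allVecs n)

  spanSubset : ∀ {d} → Vec Vn d → List Vn
  spanSubset B = filter (inSpan? B) (allVecs n)

  spanSubset∈subsets : ∀ {d} (B : Vec Vn d) → spanSubset B ∈ subsets
  spanSubset∈subsets B = filter∈sublists (inSpan? B) (allVecs n)

  ∈spanSubset⁺ : ∀ {d} {B : Vec Vn d} {w} → InSpan B w → w ∈ spanSubset B
  ∈spanSubset⁺ {B = B} = ∈-filter⁺ (inSpan? B) (∈-allVecs _)

  ∈spanSubset⁻ : ∀ {d} {B : Vec Vn d} {w} → w ∈ spanSubset B → InSpan B w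
  ∈spanSubset⁻ {B = B} w∈ = proj₂ (∈-filter⁻ (inSpan? B) {xs = allVecs n} w∈)

  spanSubset-dim : ∀ {d} (B : Vec Vn d) → LinIndep B → SubspaceOfDim d (spanSubset B)
  spanSubset-dim {d} B indep = isSubspace , size-≡
    where
    S : Subspace (InSpan B)
    S = span-subspace B
    isSubspace : IsSubspace F (spanSubset B)
    isSubspace = ∈spanSubset⁺ (0∈ S)
               , (λ u v u∈ v∈ → ∈spanSubset⁺ (⊕∈ S (∈spanSubset⁻ u∈) (∈spanSubset⁻ v∈)))
               , (λ c v v∈ → ∈spanSubset⁺ (·∈ S c (∈spanSubset⁻ v∈)))
    size-≡ : size (_∈? spanSubset B) ≡ q ^ d
    size-≡ = trans (count-cong (_∈? spanSubset B) (inSpan? B) (allVecs n) (λ _ _ → ∈spanSubset⁻) (λ _ _ → ∈spanSubset⁺))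
                   (size-span B indep)

  module Extensions {d} (Y : Vec Vn d) (Y-indep : LinIndep Y) where

    Extends : (Vn → Set) → ∀ {r} → Vec Vn r → Set
    Extends Q []      = ⊤
    Extends Q (v ∷ t) = Extends Q t × Q v × ¬ InSpan (t ++ Y) v

    extends? : ∀ {Q} → Decidable Q → ∀ {r} → Decidable (Extends Q {r})
    extends? Q? []      = yes tt
    extends? Q? (v ∷ t) = extends? Q? t ×-dec (Q? v ×-dec ¬? (inSpan? (t ++ Y) v))

    extends⇒indep : ∀ {Q r} (t : Vec Vn r) → Extends Q t → LinIndep (t ++ Y)
    extends⇒indep []      tt            = Y-indep
    extends⇒indep (v ∷ t) (ext , _ , v∉) = ∷-indep (extends⇒indep t ext) v∉

    extends⇒⊆ : ∀ {Q r} (t : Vec Vn r) → Extends Q t → VAll.All Q t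
    extends⇒⊆ []      tt             = []
    extends⇒⊆ (v ∷ t) (ext , qv , _) = qv ∷ extends⇒⊆ t ext

    extends-⊆ : ∀ {Q Q′ r} (t : Vec Vn r) → VAll.All Q′ t → Extends Q t → Extends Q′ t
    extends-⊆ []      []         tt             = tt
    extends-⊆ (v ∷ t) (q′v ∷ q′t) (ext , _ , v∉) = extends-⊆ t q′t ext , q′v , v∉

    module _ {Q : Vn → Set} (Q? : Decidable Q) (Q-subspace : Subspace Q) {m} (Q-size : size Q? ≡ q ^ m)
             (Y⊆Q : VAll.All Q Y) where

      outside? : ∀ {r} (t : Vec Vn r) → Decidable (λ v → Q v × ¬ InSpan (t ++ Y) v)
      outside? t v = Q? v ×-dec ¬? (inSpan? (t ++ Y) v)

      count-outside : ∀ {r} (t : Vec Vn r) → Extends Q t → count (outside? t) (allVecs n) ≡ q ^ m ∸ q ^ (r + d)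
      count-outside {r} t ext = begin
        count (outside? t) (allVecs n)                                  ≡⟨ sym (ℕₚ.m+n∸n≡m _ (size (inSpan? (t ++ Y)))) ⟩
        count (outside? t) (allVecs n) + size (inSpan? (t ++ Y)) ∸ size (inSpan? (t ++ Y))
          ≡⟨ cong₂ _∸_ (count-difference (inSpan? (t ++ Y)) Q? (allVecs n) span⊆Q (outside? t))
                       (size-span (t ++ Y) (extends⇒indep t ext)) ⟩
        size Q? ∸ q ^ (r + d)                                           ≡⟨ cong (_∸ q ^ (r + d)) Q-size ⟩
        q ^ m ∸ q ^ (r + d)                                             ∎
        where
        open ≡-Reasoning
        span⊆Q : ∀ x → x ∈ allVecs n → InSpan (t ++ Y) x → Q x
        span⊆Q _ _ = span-least Q-subspace (VAllₚ.++⁺ (extends⇒⊆ t ext) Y⊆Q)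

      count-extends : ∀ r → count (extends? Q?) (tuples r) ≡ extensionTuples q m d r
      count-extends zero    = refl
      count-extends (suc r) = begin
        count (extends? Q?) (tuples (suc r))
          ≡⟨ sumOver-cartesianProductWith Vec._∷_ (allVecs n) (tuples r) _ ⟩
        sumOver (allVecs n) (λ v → sumOver (tuples r) (λ t → 𝟙 (extends? Q? (v ∷ t))))
          ≡⟨ sumOver-swap (allVecs n) (tuples r) _ ⟩
        sumOver (tuples r) (λ t → count (λ v → extends? Q? (v ∷ t)) (allVecs n))
          ≡⟨ sumOver-cong (tuples r) (λ t _ → count-const× (outside? t) (extends? Q? t) (λ v → extends? Q? (v ∷ t)) (allVecs n)) ⟩
        sumOver (tuples r) (λ t → 𝟙 (extends? Q? t) * count (outside? t) (allVecs n))
          ≡⟨ sumOver-cong (tuples r) (λ t _ → outside-if-extends t (extends? Q? t)) ⟩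
        sumOver (tuples r) (λ t → 𝟙 (extends? Q? t) * (q ^ m ∸ q ^ (r + d)))
          ≡⟨ sumOver-*ʳ (tuples r) _ _ ⟩
        count (extends? Q?) (tuples r) * (q ^ m ∸ q ^ (r + d))
          ≡⟨ cong (_* (q ^ m ∸ q ^ (r + d))) (count-extends r) ⟩
        extensionTuples q m d (suc r) ∎
        where
        open ≡-Reasoning
        outside-if-extends : ∀ t (ext? : Dec (Extends Q t)) →
          𝟙 ext? * count (outside? t) (allVecs n) ≡ 𝟙 ext? * (q ^ m ∸ q ^ (r + d))
        outside-if-extends t (yes ext) = cong (1 *_) (count-outside t ext)
        outside-if-extends t (no _)    = refl

  module Between {d} (Y : Vec Vn d) (Y-indep : LinIndep Y)
                 {Z : Vn → Set} (Z? : Decidable Z) (Z-subspace : Subspace Z) {m} (Z-size : size Z? ≡ q ^ m)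
                 (Y⊆Z : VAll.All Z Y) where

    open Extensions Y Y-indep

    Between : ℕ → List Vn → Set
    Between e X = SubspaceOfDim e X × VAll.All (_∈ X) Y × All.All Z X

    between? : ∀ e → Decidable (Between e)
    between? e X = subspaceOfDim? e X ×-dec (VAll.all? (_∈? X) Y ×-dec All.all? Z? X)

    count-between-< : ∀ e → e < d → count (between? e) subsets ≡ 0
    count-between-< e e<d = count-none (between? e) subsets λ { X _ ((X-subspace , X-size) , Y⊆X , _) →
      ℕₚ.<⇒≱ e<d (indep⇒length≤dim (_∈? X) (subspace X-subspace) X-size Y-indep Y⊆X) }

    module _ (r : ℕ) where

      spanBetween : ∀ (t : Vec Vn r) → Extends Z t → Between (r + d) (spanSubset (t ++ Y)) × Extends (_∈ spanSubset (t ++ Y)) t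
      spanBetween t ext = (spanSubset-dim (t ++ Y) (extends⇒indep t ext) , Y⊆span , span⊆Z)
                        , extends-⊆ t t⊆span ext
        where
        Y⊆span : VAll.All (_∈ spanSubset (t ++ Y)) Y
        Y⊆span = VAll.map ∈spanSubset⁺ (VAllₚ.++ʳ⁻ t (span-⊇ (t ++ Y)))
        t⊆span : VAll.All (_∈ spanSubset (t ++ Y)) t
        t⊆span = VAll.map ∈spanSubset⁺ (VAllₚ.++ˡ⁻ t (span-⊇ (t ++ Y)))
        span⊆Z : All.All Z (spanSubset (t ++ Y))
        span⊆Z = All.tabulate (λ w∈ → span-least Z-subspace (VAllₚ.++⁺ (extends⇒⊆ t ext) Y⊆Z) (∈spanSubset⁻ w∈))

      -- X contains the span of t ++ Y, and both have q ^ (r + d) elements.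
      between-unique : ∀ (t : Vec Vn r) X → X ∈ subsets → Between (r + d) X → Extends (_∈ X) t → X ≡ spanSubset (t ++ Y)
      between-unique t X X∈ ((X-subspace , X-size) , Y⊆X , _) ext =
        sublists-canonical (allVecs-unique n) X∈ (spanSubset∈subsets (t ++ Y))
          (⊆-size-≡⇒⊇ (_∈? spanSubset (t ++ Y)) (_∈? X) span⊆X (trans span-size (sym X-size))) span⊆X
        where
        span⊆X : ∀ w → w ∈ spanSubset (t ++ Y) → w ∈ X
        span⊆X w w∈ = span-least (subspace X-subspace) (VAllₚ.++⁺ (extends⇒⊆ t ext) Y⊆X) (∈spanSubset⁻ w∈)
        span-size : size (_∈? spanSubset (t ++ Y)) ≡ q ^ (r + d)
        span-size = proj₂ (spanSubset-dim (t ++ Y) (extends⇒indep t ext))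

      pair? : ∀ (t : Vec Vn r) → Decidable (λ X → Between (r + d) X × Extends (_∈ X) t)
      pair? t X = between? (r + d) X ×-dec extends? (_∈? X) t

      pairs-with-tuple : ∀ (t : Vec Vn r) (ext? : Dec (Extends Z t)) → 𝟙 ext? ≡ count (pair? t) subsets
      pairs-with-tuple t (yes ext) = sym (count-unique (pair? t) subsets-unique
        (spanSubset∈subsets (t ++ Y)) (spanBetween t ext) (λ X X∈ (btw , ext) → between-unique t X X∈ btw ext))
      pairs-with-tuple t (no ¬ext) = sym (count-none (pair? t) subsets (λ { X _ ((_ , _ , X⊆Z) , ext) →
        ¬ext (extends-⊆ t (VAll.map (All.lookup X⊆Z) (extends⇒⊆ t ext)) ext) }))

      pairs-with-subspace : ∀ X (btw? : Dec (Between (r + d) X)) →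
        𝟙 btw? * count (extends? (_∈? X)) (tuples r) ≡ 𝟙 btw? * extensionTuples q (r + d) d r
      pairs-with-subspace X (yes ((X-subspace , X-size) , Y⊆X , _)) =
        cong (1 *_) (count-extends (_∈? X) (subspace X-subspace) X-size Y⊆X r)
      pairs-with-subspace X (no _) = refl

      count-pairs : count (between? (r + d)) subsets * extensionTuples q (r + d) d r ≡ extensionTuples q m d r
      count-pairs = begin
        count (between? (r + d)) subsets * extensionTuples q (r + d) d r
          ≡⟨ sym (sumOver-*ʳ subsets _ _) ⟩
        sumOver subsets (λ X → 𝟙 (between? (r + d) X) * extensionTuples q (r + d) d r)
          ≡⟨ sumOver-cong subsets (λ X _ → sym (pairs-with-subspace X (between? (r + d) X))) ⟩
        sumOver subsets (λ X → 𝟙 (between? (r + d) X) * count (extends? (_∈? X)) (tuples r))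
          ≡⟨ sumOver-cong subsets (λ X _ → sym (count-const× (extends? (_∈? X)) (between? (r + d) X) (λ t → pair? t X) (tuples r))) ⟩
        sumOver subsets (λ X → sumOver (tuples r) (λ t → 𝟙 (pair? t X)))
          ≡⟨ sumOver-swap subsets (tuples r) _ ⟩
        sumOver (tuples r) (λ t → count (pair? t) subsets)
          ≡⟨ sumOver-cong (tuples r) (λ t _ → sym (pairs-with-tuple t (extends? Z? t))) ⟩
        count (extends? Z?) (tuples r)
          ≡⟨ count-extends Z? Z-subspace Z-size Y⊆Z r ⟩
        extensionTuples q m d r ∎
        where open ≡-Reasoning

      count-between : count (between? (r + d)) subsets ≡ gauss q (m ∸ d) r
      count-between = ℕₚ.*-cancelʳ-≡ _ _ (indepTuples q r r * (q ^ d) ^ r) {{nonZero}} (begin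
        count (between? (r + d)) subsets * (indepTuples q r r * (q ^ d) ^ r)
          ≡⟨ cong (count (between? (r + d)) subsets *_) (sym (extensionTuples-shift q r d r)) ⟩
        count (between? (r + d)) subsets * extensionTuples q (r + d) d r
          ≡⟨ count-pairs ⟩
        extensionTuples q m d r
          ≡⟨ cong (λ z → extensionTuples q z d r) (sym (ℕₚ.m∸n+n≡m d≤m)) ⟩
        extensionTuples q (m ∸ d + d) d r
          ≡⟨ extensionTuples-shift q (m ∸ d) d r ⟩
        indepTuples q (m ∸ d) r * (q ^ d) ^ r
          ≡⟨ cong (_* (q ^ d) ^ r) (sym (gauss*indepTuples q (m ∸ d) r)) ⟩
        gauss q (m ∸ d) r * indepTuples q r r * (q ^ d) ^ r
          ≡⟨ ℕₚ.*-assoc (gauss q (m ∸ d) r) _ _ ⟩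
        gauss q (m ∸ d) r * (indepTuples q r r * (q ^ d) ^ r) ∎)
        where
        open ≡-Reasoning
        d≤m : d ≤ m
        d≤m = indep⇒length≤dim Z? Z-subspace Z-size Y-indep Y⊆Z
        nonZero : ℕ.NonZero (indepTuples q r r * (q ^ d) ^ r)
        nonZero = ℕ.>-nonZero (ℕₚ.*-mono-≤ (indepTuples-pos q 1<q r) (ℕₚ.m^n>0 (q ^ d) {{ℕₚ.m^n≢0 q d}} r))

module DoubleCounting (F : FiniteField) (n : ℕ) (T : V F n → V F n) (linear : IsLinear F T) where

  open Counting
  open Enumeration
  open GaussianBinomials
  open import Defs using (IsSubspace; CountSubsets; NProp; gauss)
  open import Data.Nat as ℕ using (ℕ; _+_; _*_; _^_; _∸_; _≤_; s≤s)
  import Data.Nat.Properties as ℕₚ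
  open import Data.List as List using (List; []; upTo)
  open import Data.List.Membership.Propositional using (_∈_)
  open import Data.List.Membership.Propositional.Properties using (∈-upTo⁺)
  open import Data.List.Relation.Unary.All as All using ()
  import Data.List.Relation.Unary.Unique.Propositional.Properties as Uniqueₚ
  import Data.List.Properties as Listₚ
  open import Data.Vec as Vec using (Vec; []; _++_)
  import Data.Vec.Properties as Vecₚ
  open import Data.Vec.Relation.Unary.All as VAll using ([])
  import Data.Vec.Relation.Unary.All.Properties as VAllₚ
  open import Data.Product using (Σ; _×_; _,_; proj₁; proj₂)
  open import Data.Unit using (⊤; tt)
  open import Relation.Nullary using (Dec; yes; no)
  open import Relation.Nullary.Decidable using (_×-dec_)
  open import Relation.Unary using (Decidable)
  open import Relation.Binary.PropositionalEquality
  open import Function.Bundles using (Equivalence)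

  open FiniteField F using (Carrier; q; -_; 1#)
  open LinearAlgebra F
  open SubspaceCounting F n

  _∈∩T⁻¹_ : Vn → List Vn → Set
  v ∈∩T⁻¹ W = v ∈ W × T v ∈ W

  _∈∩T⁻¹?_ : ∀ v W → Dec (v ∈∩T⁻¹ W)
  v ∈∩T⁻¹? W = (v ∈? W) ×-dec (T v ∈? W)

  ∩T⁻¹-subspace : ∀ {W} → IsSubspace F W → Subspace (_∈∩T⁻¹ W)
  ∩T⁻¹-subspace {W} W-subspace = record
    { 0∈ = 0∈ S , subst (_∈ W) (sym (linear-0 linear)) (0∈ S)
    ; ⊕∈ = λ { {u} {v} (u∈ , Tu∈) (v∈ , Tv∈) →
               ⊕∈ S u∈ v∈ , subst (_∈ W) (sym (proj₁ linear u v)) (⊕∈ S Tu∈ Tv∈) }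
    ; ·∈ = λ { c {v} (v∈ , Tv∈) → ·∈ S c v∈ , subst (_∈ W) (sym (proj₂ linear c v)) (·∈ S c Tv∈) }
    }
    where
    S : Subspace (_∈ W)
    S = subspace W-subspace

  Dims : ℕ → ℕ → List Vn → Set
  Dims a k W = SubspaceOfDim a W × size (_∈∩T⁻¹? W) ≡ q ^ k

  dims? : ∀ a k → Decidable (Dims a k)
  dims? a k W = subspaceOfDim? a W ×-dec (size (_∈∩T⁻¹? W) ℕ.≟ q ^ k)

  NProp⇒Dims : ∀ {a k W} → NProp F T a k W → Dims a k W
  NProp⇒Dims {W = W} (W-subspace , W-dim , ∩-dim) =
    (W-subspace , size-hasDim (_∈? W) (subspace W-subspace) W-dim) ,
    size-hasDim (_∈∩T⁻¹? W) (∩T⁻¹-subspace W-subspace) ∩-dim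

  Dims⇒NProp : ∀ {a k W} → Dims a k W → NProp F T a k W
  Dims⇒NProp {W = W} ((W-subspace , W-size) , ∩-size) =
    W-subspace , size⇒hasDim (_∈? W) (subspace W-subspace) W-size ,
    size⇒hasDim (_∈∩T⁻¹? W) (∩T⁻¹-subspace W-subspace) ∩-size

  CountSubsets⇒≡count : ∀ {a k m} → CountSubsets F n (NProp F T a k) m → m ≡ count (dims? a k) subsets
  CountSubsets⇒≡count {a} {k} (L , L-unique , L⇔ , refl) =
    length≡count (Listₚ.≡-dec _≟ᵥ_) (dims? a k) L-unique subsets-unique
      (λ W W∈L → let (W∈ , p) = Equivalence.to (L⇔ W) W∈L in W∈ , NProp⇒Dims p)
      (λ W W∈ p → Equivalence.from (L⇔ W) (W∈ , Dims⇒NProp p))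

  Incident : List Vn → List Vn → Set
  Incident U W = All.All (_∈∩T⁻¹ W) U

  incident? : ∀ U W → Dec (Incident U W)
  incident? U W = All.all? (_∈∩T⁻¹? W) U

  module AdaptedBasis {U : List Vn} (U-subspace : IsSubspace F U) where

    S : Subspace (_∈ U)
    S = subspace U-subspace

    ∩-basis : Σ ℕ (HasDim (_∈∩T⁻¹ U))
    ∩-basis = dimension (_∈∩T⁻¹? U)

    k : ℕ
    k = proj₁ ∩-basis

    C : Vec Vn k
    C = proj₁ (proj₂ ∩-basis)

    C⊆∩ : VAll.All (_∈∩T⁻¹ U) C
    C⊆∩ = proj₁ (proj₂ (proj₂ ∩-basis))

    C-indep : LinIndep C
    C-indep = proj₁ (proj₂ (proj₂ (proj₂ ∩-basis)))

    C-spans : ∀ w → w ∈∩T⁻¹ U → InSpan C w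
    C-spans = proj₂ (proj₂ (proj₂ (proj₂ ∩-basis)))

    ∩-size : size (_∈∩T⁻¹? U) ≡ q ^ k
    ∩-size = size-hasDim (_∈∩T⁻¹? U) (∩T⁻¹-subspace U-subspace) (proj₂ ∩-basis)

    open Extension (basis-extension (_∈? U) C C-indep (VAll.map proj₁ C⊆∩))
      renaming (indep to EC-indep; ⊆P to EC⊆U; spans to EC-spans) public

    U-size : size (_∈? U) ≡ q ^ (e + k)
    U-size = size-hasDim (_∈? U) S hasDim

    -- Y is a basis of U + T U, and W satisfies U ⊆ W ∩ T⁻¹W exactly when it contains Y.
    Y : Vec Vn (e + (e + k))
    Y = Vec.map T E ++ (E ++ C)

    -- If T x + y = 0 with x ∈ span E and y ∈ U, then T x ∈ U, so x ∈ U ∩ T⁻¹U = span C; as E ++ C is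
    -- independent this forces x = 0, and then y = 0.
    Y-indep : LinIndep Y
    Y-indep c Yc≡0 with Vec.splitAt e c
    ... | γ , βα , refl = trans (cong₂ _++_ γ≡0 βα≡0) (0v++0v e (e + k))
      where
      x : Vn
      x = lincomb γ E
      y : Vn
      y = lincomb βα (E ++ C)
      Tx+y≡0 : T x ⊕ y ≡ 0v
      Tx+y≡0 = trans (cong (_⊕ y) (linear-lincomb linear γ E))
                     (trans (sym (lincomb-++ γ βα (Vec.map T E) (E ++ C))) Yc≡0)
      x∈∩ : x ∈∩T⁻¹ U
      x∈∩ = lincomb∈ S (VAllₚ.++ˡ⁻ E EC⊆U) γ
          , subst (_∈ U) (sym (u+v≡0⇒u≡-v (T x) y Tx+y≡0)) (·∈ S (- 1#) (lincomb∈ S EC⊆U βα))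
      δ : Vec Carrier k
      δ = proj₁ (C-spans x x∈∩)
      γ≡0 : γ ≡ 0v
      γ≡0 = Vecₚ.++-injectiveˡ γ 0v (trans (EC-indep (γ ++ (- 1#) · δ) (begin
        lincomb (γ ++ (- 1#) · δ) (E ++ C)  ≡⟨ lincomb-++ γ _ E C ⟩
        x ⊕ lincomb ((- 1#) · δ) C          ≡⟨ cong (x ⊕_) (lincomb-· (- 1#) δ C) ⟩
        x ⊕ (- 1#) · lincomb δ C            ≡⟨ cong (λ z → x ⊕ (- 1#) · z) (proj₂ (C-spans x x∈∩)) ⟩
        x ⊕ (- 1#) · x                      ≡⟨ ⊕-inverseʳ x ⟩
        0v                                  ∎)) (sym (0v++0v e k)))
        where open ≡-Reasoning
      βα≡0 : βα ≡ 0v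
      βα≡0 = EC-indep βα (begin
        y                                 ≡⟨ sym (⊕-identityˡ y) ⟩
        0v ⊕ y                            ≡⟨ cong (_⊕ y) (sym (lincomb-0 (Vec.map T E))) ⟩
        lincomb 0v (Vec.map T E) ⊕ y      ≡⟨ cong (λ z → lincomb z (Vec.map T E) ⊕ y) (sym γ≡0) ⟩
        lincomb γ (Vec.map T E) ⊕ y       ≡⟨ cong (_⊕ y) (sym (linear-lincomb linear γ E)) ⟩
        T x ⊕ y                           ≡⟨ Tx+y≡0 ⟩
        0v                                ∎)
        where open ≡-Reasoning

    incident⇒Y⊆ : ∀ W → Incident U W → VAll.All (_∈ W) Y
    incident⇒Y⊆ W U⊆ = VAllₚ.++⁺ (VAllₚ.map⁺ (VAll.map (λ u∈ → proj₂ (All.lookup U⊆ u∈)) (VAllₚ.++ˡ⁻ E EC⊆U)))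
                                 (VAll.map (λ u∈ → proj₁ (All.lookup U⊆ u∈)) EC⊆U)

    Y⊆⇒incident : ∀ W → IsSubspace F W → VAll.All (_∈ W) Y → Incident U W
    Y⊆⇒incident W W-subspace Y⊆W = All.tabulate (λ u∈ → U⊆W u∈ , TU⊆W u∈)
      where
      SW : Subspace (_∈ W)
      SW = subspace W-subspace
      U⊆W : ∀ {u} → u ∈ U → u ∈ W
      U⊆W u∈ = span-least SW (VAllₚ.++ʳ⁻ (Vec.map T E) Y⊆W) (EC-spans _ u∈)
      T[EC]⊆W : VAll.All (λ x → T x ∈ W) (E ++ C)
      T[EC]⊆W = VAllₚ.++⁺ (VAllₚ.map⁻ (VAllₚ.++ˡ⁻ (Vec.map T E) Y⊆W)) (VAll.map (λ x∈∩ → U⊆W (proj₂ x∈∩)) C⊆∩)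
      TU⊆W : ∀ {u} → u ∈ U → T u ∈ W
      TU⊆W u∈ with EC-spans _ u∈
      ... | c , refl = subst (_∈ W) (sym (linear-lincomb linear c (E ++ C))) (lincomb∈ SW (VAllₚ.map⁺ T[EC]⊆W) c)

  full-subspace : Subspace {n} (λ _ → ⊤)
  full-subspace = record { 0∈ = tt ; ⊕∈ = λ _ _ → tt ; ·∈ = λ _ _ → tt }

  full-size : size {n} (λ _ → yes tt) ≡ q ^ n
  full-size = trans (count-all (λ _ → yes tt) (allVecs n) (λ _ _ → tt)) (length-allVecs n)

  module _ (b : ℕ) {W : List Vn} (W-subspace : IsSubspace F W) {k} (∩-size : size (_∈∩T⁻¹? W) ≡ q ^ k) where

    open Between [] []-indep (_∈∩T⁻¹? W) (∩T⁻¹-subspace W-subspace) {k} ∩-size []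

    count-subspaces-of-∩ : count (λ U → subspaceOfDim? b U ×-dec incident? U W) subsets ≡ gauss q k b
    count-subspaces-of-∩ = trans
      (count-cong (λ U → subspaceOfDim? b U ×-dec incident? U W) (between? (b + 0)) subsets
        (λ { U _ (U-dim , U⊆) → subst (λ e → SubspaceOfDim e U) (sym (ℕₚ.+-identityʳ b)) U-dim , [] , U⊆ })
        (λ { U _ (U-dim , _ , U⊆) → subst (λ e → SubspaceOfDim e U) (ℕₚ.+-identityʳ b) U-dim , U⊆ }))
      (count-between b)

  module _ (a : ℕ) {U : List Vn} (U-subspace : IsSubspace F U) where

    open AdaptedBasis U-subspace
    open Between Y Y-indep (λ _ → yes tt) full-subspace {n} full-size (VAll.universal (λ _ → tt) Y)

    count-incident≡count-between : ∀ a′ → count (λ W → subspaceOfDim? a′ W ×-dec incident? U W) subsets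
                                        ≡ count (between? a′) subsets
    count-incident≡count-between a′ = count-cong _ (between? a′) subsets
      (λ { W _ (W-dim , U⊆) → W-dim , incident⇒Y⊆ W U⊆ , All.universal (λ _ → tt) W })
      (λ { W _ (W-dim@(W-subspace , _) , Y⊆W , _) → W-dim , Y⊆⇒incident W W-subspace Y⊆W })

    count-superspaces-of-U : count (λ W → subspaceOfDim? a W ×-dec incident? U W) subsets
                             ≡ superspaceCount q n a (e + (e + k)) (e + (e + k) ℕ.≤? a)
    count-superspaces-of-U with e + (e + k) ℕ.≤? a
    ... | yes d≤a = begin
      count (λ W → subspaceOfDim? a W ×-dec incident? U W) subsets
        ≡⟨ cong (λ a′ → count (λ W → subspaceOfDim? a′ W ×-dec incident? U W) subsets) (sym (ℕₚ.m∸n+n≡m d≤a)) ⟩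
      count (λ W → subspaceOfDim? (a ∸ d + d) W ×-dec incident? U W) subsets
        ≡⟨ count-incident≡count-between (a ∸ d + d) ⟩
      count (between? (a ∸ d + d)) subsets
        ≡⟨ count-between (a ∸ d) ⟩
      gauss q (n ∸ d) (a ∸ d) ∎
      where
      open ≡-Reasoning
      d : ℕ
      d = e + (e + k)
    ... | no d≰a = trans (count-incident≡count-between a) (count-between-< a (ℕₚ.≰⇒> d≰a))

  module _ (a b : ℕ) where

    -- U + T U has dimension 2b − j when dim U = b and dim (U ∩ T⁻¹U) = j.
    superspaces : ℕ → ℕ
    superspaces j = superspaceCount q n a (b ∸ j + b) (b ∸ j + b ℕ.≤? a)

    incidences-of-W : ∀ W (W-dim? : Dec (SubspaceOfDim a W)) → 𝟙 W-dim? * count (λ U → subspaceOfDim? b U ×-dec incident? U W) subsets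
                            ≡ sumOver (upTo (suc a)) (λ k → 𝟙 (dims? a k W) * gauss q k b)
    incidences-of-W W (no ¬W-dim) =
      sym (sumOver-indicator-none (λ k → dims? a k W) _ (upTo (suc a)) (λ _ _ W-dims → ¬W-dim (proj₁ W-dims)))
    incidences-of-W W (yes W-dim@(W-subspace , W-size)) = begin
      1 * count (λ U → subspaceOfDim? b U ×-dec incident? U W) subsets  ≡⟨ ℕₚ.*-identityˡ _ ⟩
      count (λ U → subspaceOfDim? b U ×-dec incident? U W) subsets      ≡⟨ count-subspaces-of-∩ b W-subspace ∩-size ⟩
      gauss q k b
        ≡⟨ sym (sumOver-indicator-unique (λ k → dims? a k W) (λ k → gauss q k b) (Uniqueₚ.upTo⁺ (suc a))
                 (∈-upTo⁺ (s≤s k≤a)) (W-dim , ∩-size) (λ k′ W-dims → ^-injectiveʳ 1<q (trans (sym (proj₂ W-dims)) ∩-size))) ⟩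
      sumOver (upTo (suc a)) (λ k → 𝟙 (dims? a k W) * gauss q k b) ∎
      where
      open ≡-Reasoning
      ∩-dim : Σ ℕ (HasDim (_∈∩T⁻¹ W))
      ∩-dim = dimension (_∈∩T⁻¹? W)
      k = proj₁ ∩-dim
      ∩-size : size (_∈∩T⁻¹? W) ≡ q ^ k
      ∩-size = size-hasDim (_∈∩T⁻¹? W) (∩T⁻¹-subspace W-subspace) (proj₂ ∩-dim)
      k≤a : k ≤ a
      k≤a = ^-cancelʳ-≤ 1<q (subst₂ _≤_ ∩-size W-size (size-mono (_∈∩T⁻¹? W) (_∈? W) (λ _ → proj₁)))

    incidences-of-U : ∀ U (U-dim? : Dec (SubspaceOfDim b U)) → 𝟙 U-dim? * count (λ W → subspaceOfDim? a W ×-dec incident? U W) subsets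
                            ≡ sumOver (upTo (suc b)) (λ j → 𝟙 (dims? b j U) * superspaces j)
    incidences-of-U U (no ¬U-dim) =
      sym (sumOver-indicator-none (λ j → dims? b j U) _ (upTo (suc b)) (λ _ _ U-dims → ¬U-dim (proj₁ U-dims)))
    incidences-of-U U (yes U-dim@(U-subspace , U-size′)) = begin
      1 * count (λ W → subspaceOfDim? a W ×-dec incident? U W) subsets  ≡⟨ ℕₚ.*-identityˡ _ ⟩
      count (λ W → subspaceOfDim? a W ×-dec incident? U W) subsets      ≡⟨ count-superspaces-of-U a U-subspace ⟩
      superspaceCount q n a (e + (e + k)) (e + (e + k) ℕ.≤? a)               ≡⟨ cong (λ d → superspaceCount q n a d (d ℕ.≤? a)) Y-length ⟩
      superspaces k
        ≡⟨ sym (sumOver-indicator-unique (λ j → dims? b j U) superspaces (Uniqueₚ.upTo⁺ (suc b))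
                 (∈-upTo⁺ (s≤s k≤b)) (U-dim , ∩-size) (λ j U-dims → ^-injectiveʳ 1<q (trans (sym (proj₂ U-dims)) ∩-size))) ⟩
      sumOver (upTo (suc b)) (λ j → 𝟙 (dims? b j U) * superspaces j) ∎
      where
      open ≡-Reasoning
      open AdaptedBasis U-subspace
      e+k≡b : e + k ≡ b
      e+k≡b = ^-injectiveʳ 1<q (trans (sym U-size) U-size′)
      k≤b : k ≤ b
      k≤b = subst (k ≤_) e+k≡b (ℕₚ.m≤n+m k e)
      Y-length : e + (e + k) ≡ b ∸ k + b
      Y-length = begin
        e + (e + k) ≡⟨ cong (e +_) e+k≡b ⟩
        e + b       ≡⟨ cong (_+ b) (sym (trans (cong (_∸ k) (sym e+k≡b)) (ℕₚ.m+n∸n≡m e k))) ⟩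
        b ∸ k + b   ∎

    pair? : ∀ W U → Dec (SubspaceOfDim a W × (SubspaceOfDim b U × Incident U W))
    pair? W U = subspaceOfDim? a W ×-dec (subspaceOfDim? b U ×-dec incident? U W)

    double-count : sumOver (upTo (suc a)) (λ k → count (dims? a k) subsets * gauss q k b)
                 ≡ sumOver (upTo (suc b)) (λ j → count (dims? b j) subsets * superspaces j)
    double-count = begin
      sumOver (upTo (suc a)) (λ k → count (dims? a k) subsets * gauss q k b)
        ≡⟨ sumOver-cong (upTo (suc a)) (λ k _ → sym (sumOver-*ʳ subsets _ _)) ⟩
      sumOver (upTo (suc a)) (λ k → sumOver subsets (λ W → 𝟙 (dims? a k W) * gauss q k b))
        ≡⟨ sumOver-swap (upTo (suc a)) subsets _ ⟩
      sumOver subsets (λ W → sumOver (upTo (suc a)) (λ k → 𝟙 (dims? a k W) * gauss q k b))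
        ≡⟨ sumOver-cong subsets (λ W _ → sym (incidences-of-W W (subspaceOfDim? a W))) ⟩
      sumOver subsets (λ W → 𝟙 (subspaceOfDim? a W) * count (λ U → subspaceOfDim? b U ×-dec incident? U W) subsets)
        ≡⟨ sumOver-cong subsets (λ W _ → sym (count-const× _ (subspaceOfDim? a W) (pair? W) subsets)) ⟩
      sumOver subsets (λ W → count (pair? W) subsets)
        ≡⟨ sumOver-swap subsets subsets _ ⟩
      sumOver subsets (λ U → count (λ W → pair? W U) subsets)
        ≡⟨ sumOver-cong subsets (λ U _ → trans (reorder U) (count-const× _ (subspaceOfDim? b U) _ subsets)) ⟩
      sumOver subsets (λ U → 𝟙 (subspaceOfDim? b U) * count (λ W → subspaceOfDim? a W ×-dec incident? U W) subsets)
        ≡⟨ sumOver-cong subsets (λ U _ → incidences-of-U U (subspaceOfDim? b U)) ⟩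
      sumOver subsets (λ U → sumOver (upTo (suc b)) (λ j → 𝟙 (dims? b j U) * superspaces j))
        ≡⟨ sumOver-swap subsets (upTo (suc b)) _ ⟩
      sumOver (upTo (suc b)) (λ j → sumOver subsets (λ U → 𝟙 (dims? b j U) * superspaces j))
        ≡⟨ sumOver-cong (upTo (suc b)) (λ j _ → sumOver-*ʳ subsets _ _) ⟩
      sumOver (upTo (suc b)) (λ j → count (dims? b j) subsets * superspaces j) ∎
      where
      open ≡-Reasoning
      reorder : ∀ U → count (λ W → pair? W U) subsets
                    ≡ count (λ W → subspaceOfDim? b U ×-dec (subspaceOfDim? a W ×-dec incident? U W)) subsets
      reorder U = count-cong _ _ subsets (λ { W _ (x , y , z) → y , x , z }) (λ { W _ (y , x , z) → x , y , z })

module IntegerArithmetic where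

  open Counting
  open GaussianBinomials using (superspaceCount)
  open import Defs using (gaussℤ)
  open import Data.Nat as ℕ using (ℕ; suc; _≤_; _<_)
  import Data.Nat.Properties as ℕₚ
  open import Data.Integer as ℤ using (ℤ; +_; -[1+_]; _+_; _-_; _⊖_)
  import Data.Integer.Properties as ℤₚ
  open import Data.Integer.Tactic.RingSolver using (solve-∀)
  open import Data.List using (List; []; _∷_; map; foldr)
  open import Data.List.Membership.Propositional using (_∈_)
  open import Data.List.Relation.Unary.Any using (here; there)
  open import Relation.Nullary using (Dec; yes; no)
  open import Relation.Binary.PropositionalEquality

  foldr-+-pos : ∀ (xs : List ℕ) (φ : ℕ → ℤ) (f : ℕ → ℕ) → (∀ i → i ∈ xs → φ i ≡ + f i) →
                foldr _+_ (+ 0) (map φ xs) ≡ + sumOver xs f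
  foldr-+-pos []       φ f φ≡ = refl
  foldr-+-pos (x ∷ xs) φ f φ≡ =
    trans (cong₂ _+_ (φ≡ x (here refl)) (foldr-+-pos xs φ f (λ i i∈ → φ≡ i (there i∈)))) (sym (ℤₚ.pos-+ (f x) _))

  +x-b-b+j≡x⊖2b-j : ∀ x b j → j ≤ b → + x - + b - + b + + j ≡ x ⊖ (b ℕ.∸ j ℕ.+ b)
  +x-b-b+j≡x⊖2b-j x b j j≤b = begin
    + x - + b - + b + + j          ≡⟨ solve (+ x) (+ b) (+ j) ⟩
    + x - ((+ b - + j) + + b)      ≡⟨ cong (λ w → + x - (w + + b)) (trans (ℤₚ.m-n≡m⊖n b j) (ℤₚ.⊖-≥ j≤b)) ⟩
    + x - + (b ℕ.∸ j ℕ.+ b)        ≡⟨ ℤₚ.m-n≡m⊖n x (b ℕ.∸ j ℕ.+ b) ⟩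
    x ⊖ (b ℕ.∸ j ℕ.+ b)            ∎
    where
    open ≡-Reasoning
    solve : ∀ x b j → x - b - b + j ≡ x - ((b - j) + b)
    solve = solve-∀

  gaussℤ-⊖ : ∀ q {n a} d → a ≤ n → (d≤a? : Dec (d ≤ a)) → gaussℤ q (n ⊖ d) (a ⊖ d) ≡ + superspaceCount q n a d d≤a?
  gaussℤ-⊖ q d a≤n (yes d≤a) rewrite ℤₚ.⊖-≥ d≤a | ℤₚ.⊖-≥ (ℕₚ.≤-trans d≤a a≤n) = refl
  gaussℤ-⊖ q {n} {a} d a≤n (no d≰a) rewrite ℤₚ.⊖-< (ℕₚ.≰⇒> d≰a) =
    below-zero (n ⊖ d) (ℕₚ.m<n⇒0<n∸m (ℕₚ.≰⇒> d≰a))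
    where
    below-zero : ∀ z {m} → 0 < m → gaussℤ q z (ℤ.- (+ m)) ≡ + 0
    below-zero (+ _)    {suc _} _ = refl
    below-zero -[1+ _ ] {suc _} _ = refl

  isolate : ∀ (x y z u v : ℤ) → x + y + z ≡ u + v → x ≡ ((v - z) + u) - y
  isolate x y z u v e = begin
    x                      ≡⟨ solve₁ x y z ⟩
    (x + y + z) - z - y    ≡⟨ cong (λ w → w - z - y) e ⟩
    (u + v) - z - y        ≡⟨ solve₂ u v z y ⟩
    ((v - z) + u) - y      ∎
    where
    open ≡-Reasoning
    solve₁ : ∀ x y z → x ≡ (x + y + z) - z - y
    solve₁ = solve-∀
    solve₂ : ∀ u v z y → (u + v) - z - y ≡ ((v - z) + u) - y
    solve₂ = solve-∀

module Proposition (F : FiniteField) (n : ℕ) (T : V F n → V F n) (linear : IsLinear F T) (N : ℕ → ℕ → ℕ)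
                   (N-counts : ∀ a b → b ≤ a → a ≤ n → CountSubsets F n (NProp F T a b) (N a b))
                   {a b : ℕ} (b<a : b < a) (a≤n : a ≤ n) where

  open Counting
  open GaussianBinomials using (gauss-<; gauss-diagonal; superspaceCount; superspaceCount-≤)
  open IntegerArithmetic
  open import Defs using (gauss)
  open import Data.Nat as ℕ using ()
  import Data.Nat.Properties as ℕₚ
  open import Data.Integer using (ℤ; +_; _+_; _-_; _*_)
  import Data.Integer.Properties as ℤₚ
  open import Data.List using (upTo)
  open import Data.List.Membership.Propositional.Properties using (∈-upTo⁻)
  open import Relation.Binary.PropositionalEquality
  open DoubleCounting F n T linear
  open SubspaceCounting F n using (subsets)
  open FiniteField F using (q)

  b≤a : b ≤ a
  b≤a = ℕₚ.<⇒≤ b<a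

  b≤n : b ≤ n
  b≤n = ℕₚ.≤-trans b≤a a≤n

  N≡count : ∀ {x y} → y ≤ x → x ≤ n → N x y ≡ count (dims? x y) subsets
  N≡count y≤x x≤n = CountSubsets⇒≡count (N-counts _ _ y≤x x≤n)

  lowerSum : ℕ
  lowerSum = sumOver (upTo b) (λ j → N b j ℕ.* superspaces a b j)

  upperSum : ℕ
  upperSum = sumOver (upTo (a ℕ.∸ suc b)) (λ i → N a (suc b ℕ.+ i) ℕ.* gauss q (suc b ℕ.+ i) b)

  W-sum-split : sumOver (upTo (suc a)) (λ k → N a k ℕ.* gauss q k b) ≡ N a b ℕ.+ upperSum ℕ.+ N a a ℕ.* gauss q a b
  W-sum-split = begin
    sumOver (upTo (suc a)) h
      ≡⟨ sumOver-upTo-suc h a ⟩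
    sumOver (upTo a) h ℕ.+ h a
      ≡⟨ cong (λ m → sumOver (upTo m) h ℕ.+ h a) (sym (ℕₚ.m+[n∸m]≡n b<a)) ⟩
    sumOver (upTo (suc b ℕ.+ (a ℕ.∸ suc b))) h ℕ.+ h a
      ≡⟨ cong (ℕ._+ h a) (sumOver-upTo-+ h (suc b) _) ⟩
    sumOver (upTo (suc b)) h ℕ.+ upperSum ℕ.+ h a
      ≡⟨ cong (λ s → s ℕ.+ upperSum ℕ.+ h a) (sumOver-upTo-suc h b) ⟩
    sumOver (upTo b) h ℕ.+ h b ℕ.+ upperSum ℕ.+ h a
      ≡⟨ cong (λ s → s ℕ.+ h b ℕ.+ upperSum ℕ.+ h a) below-b ⟩
    N a b ℕ.* gauss q b b ℕ.+ upperSum ℕ.+ h a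
      ≡⟨ cong (λ g → N a b ℕ.* g ℕ.+ upperSum ℕ.+ h a) (gauss-diagonal q b) ⟩
    N a b ℕ.* 1 ℕ.+ upperSum ℕ.+ h a
      ≡⟨ cong (λ m → m ℕ.+ upperSum ℕ.+ h a) (ℕₚ.*-identityʳ (N a b)) ⟩
    N a b ℕ.+ upperSum ℕ.+ h a ∎
    where
    open ≡-Reasoning
    h : ℕ → ℕ
    h k = N a k ℕ.* gauss q k b
    below-b : sumOver (upTo b) h ≡ 0
    below-b = trans (sumOver-cong (upTo b) (λ k k∈ →
                        trans (cong (N a k ℕ.*_) (gauss-< q k b (∈-upTo⁻ k∈))) (ℕₚ.*-zeroʳ (N a k))))
                    (sumOver-zero (upTo b))

  U-sum-split : sumOver (upTo (suc b)) (λ j → N b j ℕ.* superspaces a b j) ≡ lowerSum ℕ.+ N b b ℕ.* gauss q (n ℕ.∸ b) (a ℕ.∸ b)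
  U-sum-split = trans (sumOver-upTo-suc _ b) (cong (λ s → lowerSum ℕ.+ N b b ℕ.* s)
    (trans (cong (λ d → superspaceCount q n a d (d ℕ.≤? a)) (cong (ℕ._+ b) (ℕₚ.n∸n≡0 b)))
           (superspaceCount-≤ q n b≤a (b ℕ.≤? a))))

  natural-identity : N a b ℕ.+ upperSum ℕ.+ N a a ℕ.* gauss q a b ≡ lowerSum ℕ.+ N b b ℕ.* gauss q (n ℕ.∸ b) (a ℕ.∸ b)
  natural-identity = begin
    N a b ℕ.+ upperSum ℕ.+ N a a ℕ.* gauss q a b
      ≡⟨ sym W-sum-split ⟩
    sumOver (upTo (suc a)) (λ k → N a k ℕ.* gauss q k b)
      ≡⟨ sumOver-cong (upTo (suc a)) (λ k k∈ → cong (ℕ._* gauss q k b) (N≡count (ℕₚ.≤-pred (∈-upTo⁻ k∈)) a≤n)) ⟩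
    sumOver (upTo (suc a)) (λ k → count (dims? a k) subsets ℕ.* gauss q k b)
      ≡⟨ double-count a b ⟩
    sumOver (upTo (suc b)) (λ j → count (dims? b j) subsets ℕ.* superspaces a b j)
      ≡⟨ sumOver-cong (upTo (suc b)) (λ j j∈ → cong (ℕ._* superspaces a b j) (sym (N≡count (ℕₚ.≤-pred (∈-upTo⁻ j∈)) b≤n))) ⟩
    sumOver (upTo (suc b)) (λ j → N b j ℕ.* superspaces a b j)
      ≡⟨ U-sum-split ⟩
    lowerSum ℕ.+ N b b ℕ.* gauss q (n ℕ.∸ b) (a ℕ.∸ b) ∎
    where open ≡-Reasoning

  lowerSumℤ : ℤ
  lowerSumℤ = ∑[ 0 , b ⟩ (λ j → + N b j * gaussℤ q (+ n - + b - + b + + j) (+ a - + b - + b + + j))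

  upperSumℤ : ℤ
  upperSumℤ = ∑[ suc b , a ⟩ (λ k → + N a k * gaussℤ q (+ k) (+ b))

  lowerSum≡∑ : + lowerSum ≡ lowerSumℤ
  lowerSum≡∑ = sym (foldr-+-pos (upTo b) _ _ (λ j j∈ →
    trans (cong (+ N b j *_) (gaussℤ≡superspaces j (ℕₚ.<⇒≤ (∈-upTo⁻ j∈)))) (sym (ℤₚ.pos-* (N b j) _))))
    where
    gaussℤ≡superspaces : ∀ j → j ≤ b → gaussℤ q (+ n - + b - + b + + j) (+ a - + b - + b + + j) ≡ + superspaces a b j
    gaussℤ≡superspaces j j≤b rewrite +x-b-b+j≡x⊖2b-j n b j j≤b | +x-b-b+j≡x⊖2b-j a b j j≤b =
      gaussℤ-⊖ q (b ℕ.∸ j ℕ.+ b) a≤n (b ℕ.∸ j ℕ.+ b ℕ.≤? a)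

  upperSum≡∑ : + upperSum ≡ upperSumℤ
  upperSum≡∑ = sym (foldr-+-pos (upTo (a ℕ.∸ suc b)) _ _ (λ i _ → sym (ℤₚ.pos-* (N a (suc b ℕ.+ i)) _)))

  leading-term≡ : + (N b b ℕ.* gauss q (n ℕ.∸ b) (a ℕ.∸ b)) ≡ + N b b * gaussℤ q (+ n - + b) (+ a - + b)
  leading-term≡ rewrite ℤₚ.m-n≡m⊖n n b | ℤₚ.⊖-≥ b≤n | ℤₚ.m-n≡m⊖n a b | ℤₚ.⊖-≥ b≤a = ℤₚ.pos-* (N b b) _

  integer-identity : + N a b + upperSumℤ + + N a a * gaussℤ q (+ a) (+ b)
                     ≡ lowerSumℤ + + N b b * gaussℤ q (+ n - + b) (+ a - + b)
  integer-identity = begin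
    + N a b + upperSumℤ + + N a a * gaussℤ q (+ a) (+ b)
      ≡⟨ cong₂ (λ s t → + N a b + s + t) (sym upperSum≡∑) (sym (ℤₚ.pos-* (N a a) _)) ⟩
    + N a b + + upperSum + + (N a a ℕ.* gauss q a b)
      ≡⟨ cong (_+ + (N a a ℕ.* gauss q a b)) (sym (ℤₚ.pos-+ (N a b) upperSum)) ⟩
    + (N a b ℕ.+ upperSum) + + (N a a ℕ.* gauss q a b)
      ≡⟨ sym (ℤₚ.pos-+ (N a b ℕ.+ upperSum) _) ⟩
    + (N a b ℕ.+ upperSum ℕ.+ N a a ℕ.* gauss q a b)
      ≡⟨ cong +_ natural-identity ⟩
    + (lowerSum ℕ.+ N b b ℕ.* gauss q (n ℕ.∸ b) (a ℕ.∸ b))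
      ≡⟨ ℤₚ.pos-+ lowerSum _ ⟩
    + lowerSum + + (N b b ℕ.* gauss q (n ℕ.∸ b) (a ℕ.∸ b))
      ≡⟨ cong₂ _+_ lowerSum≡∑ leading-term≡ ⟩
    lowerSumℤ + + N b b * gaussℤ q (+ n - + b) (+ a - + b) ∎
    where open ≡-Reasoning

open import Data.Integer using (ℤ; +_; _+_; _-_; _*_)
open IntegerArithmetic using (isolate)

proposition3p3 : (F : FiniteField) (n : ℕ) (T : V F n → V F n) → IsLinear F T →
  (N : ℕ → ℕ → ℕ) →
  (∀ a b → b ≤ a → a ≤ n → CountSubsets F n (NProp F T a b) (N a b)) →
  ∀ a b → b < a → a ≤ n →
    + N a b ≡
      ((+ N b b * gaussℤ (FiniteField.q F) (+ n - + b) (+ a - + b)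
        - + N a a * gaussℤ (FiniteField.q F) (+ a) (+ b))
       + ∑[ 0 , b ⟩ (λ j → + N b j
           * gaussℤ (FiniteField.q F) (+ n - + b - + b + + j) (+ a - + b - + b + + j)))
       - ∑[ suc b , a ⟩ (λ k → + N a k * gaussℤ (FiniteField.q F) (+ k) (+ b))
proposition3p3 F n T linear N N-counts a b b<a a≤n =
  isolate (+ N a b) upperSumℤ (+ N a a * gaussℤ q (+ a) (+ b)) lowerSumℤ (+ N b b * gaussℤ q (+ n - + b) (+ a - + b))
    integer-identity
  where
  open Proposition F n T linear N N-counts b<a a≤n
  open FiniteField F using (q)
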